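{- For every integer $k\geq 2$, the sequences (indexed by odd primes $p$) \[ p^k\sum_{n=1}^{(p-1)/2}\frac{1}{n^k}\qquad\text{and}\qquad p^k\sum_{n=1}^{p-1}\frac{(-1)^n}{n^k} \] are in the weighted MHS algebra.
   Context: A composition is a finite list $\mathbf{s}=(s_1,\ldots,s_j)$ of positive integers with weight $|\mathbf{s}|=s_1+\cdots+s_j$; $H_N(\mathbf{s})=\sum_{N\ge n_1>\cdots>n_j\ge1}\frac{1}{n_1^{s_1}\cdots n_j^{s_j}}$ and $h_p(\mathbf{s})=p^{|\mathbf{s}|}H_{p-1}(\mathbf{s})$. Let $\mathbb{Q}_{p\to\infty}$ be the quotient of the ring of sequences $(a_p)_p\in\prod_p\mathbb{Q}_p$ with $v_p(a_p)$ bounded below, by the ideal of sequences with $v_p(a_p)\to\infty$ (quantities defined for all but finitely many $p$ give elements). The weighted MHS algebra is the set of $(a_p)$ for which there exist rationals $c_i$ and compositions $\mathbf{s}_i$ with $|\mathbf{s}_i|\to\infty$, independent of $p$, such that for every integer $n$, $a_p\equiv\sum_{|\mathbf{s}_i|<n}c_ih_p(\mathbf{s}_i)\pmod{p^n}$ for all sufficiently large $p$. -}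

module Defs where

open import Data.Nat as ℕ using (ℕ; zero; suc; _^_; _∸_; _≤_; _<_)
open import Data.Nat.Divisibility using (_∣_)
open import Data.Nat.ListAction using (sum)
open import Data.Nat.Properties using (m^n≢0)
open import Data.Nat.Primality using (Prime)
open import Data.Integer as ℤ using (ℤ; +_; ∣_∣)
open import Data.Rational using (ℚ; 0ℚ; 1ℚ; _+_; _*_; _-_; -_; _/_; ↥_; ↧ₙ_)
open import Data.List using (List; []; _∷_)
open import Data.List.Relation.Unary.All using (All)
open import Data.Product using (Σ; _×_; ∃)
open import Relation.Nullary using (¬_)

inv^ : ℕ → ℕ → ℚ
inv^ zero    k = 0ℚ      -- never used (indices start at 1)
inv^ (suc m) k = _/_ (+ 1) (suc m ^ k) {{m^n≢0 (suc m) k}}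

Σ1 : ℕ → (ℕ → ℚ) → ℚ
Σ1 zero    f = 0ℚ
Σ1 (suc N) f = Σ1 N f + f (suc N)

ℕ→ℚ : ℕ → ℚ
ℕ→ℚ n = (+ n) / 1

Composition : Set
Composition = List ℕ

IsComposition : Composition → Set
IsComposition s = All (1 ≤_) s

weight : Composition → ℕ
weight s = sum s

-- H_N(s) = Σ_{N ≥ n₁ > ⋯ > n_j ≥ 1} 1/(n₁^{s₁} ⋯ n_j^{s_j})
H : ℕ → Composition → ℚ
H N []       = 1ℚ
H N (s ∷ ss) = Σ1 N (λ n → inv^ n s * H (n ∸ 1) ss)

h : ℕ → Composition → ℚ
h p s = ℕ→ℚ (p ^ weight s) * H (p ∸ 1) s

-- v_p(x) ≥ n  (x normalised: p^n divides the numerator, p does not divide the denominator)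
ValGe : ℕ → ℕ → ℚ → Set
ValGe p n x = ((p ^ n) ∣ ∣ (↥ x) ∣) × ¬ (p ∣ ↧ₙ x)

CongMod : ℕ → ℕ → ℚ → ℚ → Set
CongMod p n a b = ValGe p n (a - b)

partialSum : (ℕ → ℚ) → (ℕ → Composition) → ℕ → ℕ → ℕ → ℚ
partialSum c s p n zero    = 0ℚ
partialSum c s p n (suc M) with weight (s M) ℕ.<? n
... | Relation.Nullary.yes _ = partialSum c s p n M + c M * h p (s M)
... | Relation.Nullary.no  _ = partialSum c s p n M

-- a sequence (a_p), indexed by primes, lies in the weighted MHS algebra:
-- there are rationals c_i and compositions s_i with |s_i| → ∞ (with explicit modulus N:
-- i ≥ N n ⇒ |s_i| ≥ n), such that for every n, for all sufficiently large primes p,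
-- a_p ≡ Σ_{|s_i| < n} c_i h_p(s_i) (mod p^n).  Since |s_i| ≥ n for i ≥ N n, the
-- sum over {i : |s_i| < n} equals the sum over {i < N n : |s_i| < n}.
InWeightedMHS : (ℕ → ℚ) → Set
InWeightedMHS a =
  Σ (ℕ → ℚ) λ c →
  Σ (ℕ → Composition) λ s →
  Σ (ℕ → ℕ) λ N →
    ((i : ℕ) → IsComposition (s i)) ×
    ((n i : ℕ) → N n ≤ i → n ≤ weight (s i)) ×
    ((n : ℕ) → ∃ λ P → (p : ℕ) → Prime p → P < p →
        CongMod p n (a p) (partialSum c s p n (N n)))

halfSum : ℕ → ℕ → ℚ
halfSum k p = ℕ→ℚ (p ^ k) * Σ1 ((p ∸ 1) ℕ./ 2) (λ n → inv^ n k)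

sign : ℕ → ℚ
sign zero          = 1ℚ
sign (suc zero)    = - 1ℚ
sign (suc (suc n)) = sign n

altSum : ℕ → ℕ → ℚ
altSum k p = ℕ→ℚ (p ^ k) * Σ1 (p ∸ 1) (λ n → sign n * inv^ n k)

module Submission where

-- For k ≥ 2 and odd primes p, the half sums W_k = p^k Σ_{n ≤ (p-1)/2} 1/n^k and the
-- alternating sums p^k Σ_{n<p} (-1)^n/n^k are congruent, modulo p^n for all large p,
-- to combinations Σ_{i<n} c_i h_p(i) of depth-one values with p-independent c_i, which
-- places them in the weighted MHS algebra.
--
-- Reflecting x ↦ p - x and expanding
-- (1 - p/x)^{-k} as a binomial series (module Expansions) gives two congruences
--   h_p(k) ≡ W_k + (-1)^k Σ_j C(k+j-1, j) W_{k+j}            (reflect-upper),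
--   2^k h_p(k) ≡ W_k + (-1)^k Σ_j C(k+j-1, j) 2^{-j} W_{k+j}  (reflect-odd-scaled).
-- For odd k they can be solved for W_{k+1} and for W_{k+2} in terms of h_p(k) and higher
-- W's (solve-W₁, solve-W₂).  As W_m ≡ 0 (mod p^m), iterating this downward recursion
-- terminates and gives W_m ≡ Σ_{i<n} d m i·h_p(i) with explicit coefficients d
-- (expansion), valid once p exceeds the pivots inverted along the way.  The alternating
-- sum equals 2^{1-k} W_k - h_p(k) (altSum≡); theorem5 recasts both expansions as the
-- partial sums of Defs.

open import Defs
open import Level using (0ℓ)
open import Data.Nat as ℕ using (ℕ; zero; suc; _≤_)
import Data.Nat.Properties as ℕP
import Data.Nat.Tactic.RingSolver as ℕSolver
import Data.Nat.DivMod as ℕDM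
open import Data.Nat.Divisibility as ℕD using (_∣_; divides)
open import Data.Nat.Primality using (Prime; composite; prime⇒¬composite; euclidsLemma; prime⇒nonZero; prime⇒nonTrivial)
open import Data.Integer as ℤ using (ℤ) renaming (+_ to ⁺_)
import Data.Integer.Properties as ℤP
import Data.Integer.GCD as ℤG
open import Data.Rational using (ℚ; 0ℚ; 1ℚ; _+_; _*_; _-_; -_; _/_; ↥_; ↧_; ↧ₙ_; toℚᵘ; fromℚᵘ)
open import Data.Rational.Properties
import Data.Rational.Unnormalised as U
import Data.Rational.Unnormalised.Properties as UP
open import Algebra.Bundles using (CommutativeRing)
open import Algebra.Properties.CommutativeSemiring.Exp (CommutativeRing.commutativeSemiring +-*-commutativeRing)
  using (_^_; ^-homo-*; ^-distrib-*)
open import Data.Maybe using (Maybe; just; nothing)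
open import Data.Product using (_×_; _,_; proj₁; proj₂; ∃)
open import Data.Sum using (_⊎_; inj₁; inj₂)
open import Data.List using ([]; _∷_)
open import Data.List.Relation.Unary.All using ([]; _∷_)
open import Data.Empty using (⊥-elim)
open import Relation.Nullary using (¬_; yes; no)
open import Relation.Binary.PropositionalEquality
open import Tactic.RingSolver using (solve-∀)
open import Tactic.RingSolver.Core.AlmostCommutativeRing using (AlmostCommutativeRing; fromCommutativeRing)

ℚ-ring : AlmostCommutativeRing 0ℓ 0ℓ
ℚ-ring = fromCommutativeRing +-*-commutativeRing isZero
  where
  isZero : ∀ x → Maybe (0ℚ ≡ x)
  isZero x with 0ℚ ≟ x
  ... | yes e = just e
  ... | no _  = nothing

-- The embedding ℕ → ℚ of Defs is a semiring homomorphism; we compare it with the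
-- unnormalised fraction n/1, where addition and multiplication are syntactic.
↥-ℕ→ℚ : ∀ n → ↥ (ℕ→ℚ n) ≡ ⁺ n
↥-ℕ→ℚ n = trans (sym (ℤP.*-identityʳ _))
  (trans (cong (↥ (ℕ→ℚ n) ℤ.*_) (sym (ℤG.gcd-zeroʳ (⁺ n)))) (↥-/ (⁺ n) 1))

↧-ℕ→ℚ : ∀ n → ↧ (ℕ→ℚ n) ≡ ⁺ 1
↧-ℕ→ℚ n = trans (sym (ℤP.*-identityʳ _))
  (trans (cong (↧ (ℕ→ℚ n) ℤ.*_) (sym (ℤG.gcd-zeroʳ (⁺ n)))) (↧-/ (⁺ n) 1))

toℚᵘ-ℕ→ℚ : ∀ n → toℚᵘ (ℕ→ℚ n) U.≃ U.mkℚᵘ (⁺ n) 0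
toℚᵘ-ℕ→ℚ n = U.*≡* (trans (cong (ℤ._* ⁺ 1) (trans (↥ᵘ-toℚᵘ (ℕ→ℚ n)) (↥-ℕ→ℚ n)))
                          (cong (⁺ n ℤ.*_) (sym (trans (↧ᵘ-toℚᵘ (ℕ→ℚ n)) (↧-ℕ→ℚ n)))))

ℕ→ℚ-+ : ∀ m n → ℕ→ℚ (m ℕ.+ n) ≡ ℕ→ℚ m + ℕ→ℚ n
ℕ→ℚ-+ m n = toℚᵘ-injective (UP.≃-trans (toℚᵘ-ℕ→ℚ (m ℕ.+ n)) (UP.≃-trans sumᵘ
  (UP.≃-sym (UP.≃-trans (toℚᵘ-homo-+ (ℕ→ℚ m) (ℕ→ℚ n)) (UP.+-cong (toℚᵘ-ℕ→ℚ m) (toℚᵘ-ℕ→ℚ n))))))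
  where
  sumᵘ : U.mkℚᵘ (⁺ (m ℕ.+ n)) 0 U.≃ (U.mkℚᵘ (⁺ m) 0 U.+ U.mkℚᵘ (⁺ n) 0)
  sumᵘ = U.*≡* (cong (ℤ._* ⁺ 1) (sym (cong₂ ℤ._+_ (ℤP.*-identityʳ (⁺ m)) (ℤP.*-identityʳ (⁺ n)))))

ℕ→ℚ-* : ∀ m n → ℕ→ℚ (m ℕ.* n) ≡ ℕ→ℚ m * ℕ→ℚ n
ℕ→ℚ-* m n = toℚᵘ-injective (UP.≃-trans (toℚᵘ-ℕ→ℚ (m ℕ.* n)) (UP.≃-trans productᵘ
  (UP.≃-sym (UP.≃-trans (toℚᵘ-homo-* (ℕ→ℚ m) (ℕ→ℚ n)) (UP.*-cong (toℚᵘ-ℕ→ℚ m) (toℚᵘ-ℕ→ℚ n))))))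
  where
  productᵘ : U.mkℚᵘ (⁺ (m ℕ.* n)) 0 U.≃ (U.mkℚᵘ (⁺ m) 0 U.* U.mkℚᵘ (⁺ n) 0)
  productᵘ = U.*≡* (cong (ℤ._* ⁺ 1) (ℤP.pos-* m n))

ℕ→ℚ-^ : ∀ n k → ℕ→ℚ (n ℕ.^ k) ≡ ℕ→ℚ n ^ k
ℕ→ℚ-^ n zero    = refl
ℕ→ℚ-^ n (suc k) = trans (ℕ→ℚ-* n (n ℕ.^ k)) (cong (ℕ→ℚ n *_) (ℕ→ℚ-^ n k))

recip-inverse : ∀ n .{{_ : ℕ.NonZero n}} → (⁺ 1 / n) * ℕ→ℚ n ≡ 1ℚ
recip-inverse (suc t) = toℚᵘ-injective
  (UP.≃-trans (toℚᵘ-homo-* (fromℚᵘ (U.mkℚᵘ (⁺ 1) t)) (ℕ→ℚ (suc t)))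
  (UP.≃-trans (UP.*-cong (toℚᵘ-fromℚᵘ (U.mkℚᵘ (⁺ 1) t)) (toℚᵘ-ℕ→ℚ (suc t)))
  (UP.≃-trans (UP.*-comm (U.mkℚᵘ (⁺ 1) t) (U.mkℚᵘ (⁺ suc t) 0)) (UP.*-inverseʳ (U.mkℚᵘ (⁺ suc t) 0)))))

-- 1/n, with the junk value 0 at n = 0.
recip : ℕ → ℚ
recip zero    = 0ℚ
recip (suc n) = ⁺ 1 / suc n

recip-inverse′ : ∀ n → 1 ≤ n → recip n * ℕ→ℚ n ≡ 1ℚ
recip-inverse′ (suc n) _ = recip-inverse (suc n)

inverse-unique : ∀ {y z a} → y * a ≡ 1ℚ → z * a ≡ 1ℚ → y ≡ z
inverse-unique {y} {z} {a} ya≡1 za≡1 = begin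
  y            ≡⟨ sym (*-identityʳ y) ⟩
  y * 1ℚ       ≡⟨ cong (y *_) (sym za≡1) ⟩
  y * (z * a)  ≡⟨ swap y z a ⟩
  z * (y * a)  ≡⟨ cong (z *_) ya≡1 ⟩
  z * 1ℚ       ≡⟨ *-identityʳ z ⟩
  z            ∎
  where
  open ≡-Reasoning
  swap : ∀ a b c → a * (b * c) ≡ b * (a * c)
  swap = solve-∀ ℚ-ring

inv^-inverse : ∀ m k → inv^ (suc m) k * ℕ→ℚ (suc m ℕ.^ k) ≡ 1ℚ
inv^-inverse m k = recip-inverse (suc m ℕ.^ k) {{ℕP.m^n≢0 (suc m) k}}

inv-inverse : ∀ m → inv^ (suc m) 1 * ℕ→ℚ (suc m) ≡ 1ℚ
inv-inverse m = trans (cong (λ t → inv^ (suc m) 1 * ℕ→ℚ t) (sym (ℕP.*-identityʳ (suc m)))) (inv^-inverse m 1)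

1^ : ∀ k → 1ℚ ^ k ≡ 1ℚ
1^ zero    = refl
1^ (suc k) = trans (*-identityˡ (1ℚ ^ k)) (1^ k)

inv^-power : ∀ m k → inv^ (suc m) k ≡ inv^ (suc m) 1 ^ k
inv^-power m k = inverse-unique (inv^-inverse m k) (begin
  inv^ (suc m) 1 ^ k * ℕ→ℚ (suc m ℕ.^ k)   ≡⟨ cong (inv^ (suc m) 1 ^ k *_) (ℕ→ℚ-^ (suc m) k) ⟩
  inv^ (suc m) 1 ^ k * ℕ→ℚ (suc m) ^ k     ≡⟨ sym (^-distrib-* (inv^ (suc m) 1) (ℕ→ℚ (suc m)) k) ⟩
  (inv^ (suc m) 1 * ℕ→ℚ (suc m)) ^ k       ≡⟨ cong (_^ k) (inv-inverse m) ⟩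
  1ℚ ^ k                                   ≡⟨ 1^ k ⟩
  1ℚ                                       ∎)
  where open ≡-Reasoning

-- The ratio p/x; the summands of h_p(k) and of the half sums are its k-th powers.
ratio : ℕ → ℕ → ℚ
ratio p x = ℕ→ℚ p * inv^ x 1

ratio-power : ∀ p m k → ℕ→ℚ (p ℕ.^ k) * inv^ (suc m) k ≡ ratio p (suc m) ^ k
ratio-power p m k = trans (cong₂ _*_ (ℕ→ℚ-^ p k) (inv^-power m k))
                          (sym (^-distrib-* (ℕ→ℚ p) (inv^ (suc m) 1) k))

two : ℚ
two = 1ℚ + 1ℚ

½ : ℚ
½ = ⁺ 1 / 2

two*½ : two * ½ ≡ 1ℚ
two*½ = trans (*-comm two ½) (recip-inverse 2)

2^k*½^k : ∀ k → two ^ k * ½ ^ k ≡ 1ℚ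
2^k*½^k k = trans (sym (^-distrib-* two ½ k)) (trans (cong (_^ k) two*½) (1^ k))

2^k*½^[k+j] : ∀ k j → two ^ k * ½ ^ (k ℕ.+ j) ≡ ½ ^ j
2^k*½^[k+j] k j = begin
  two ^ k * ½ ^ (k ℕ.+ j)     ≡⟨ cong (two ^ k *_) (^-homo-* ½ k j) ⟩
  two ^ k * (½ ^ k * ½ ^ j)   ≡⟨ sym (*-assoc (two ^ k) (½ ^ k) (½ ^ j)) ⟩
  two ^ k * ½ ^ k * ½ ^ j     ≡⟨ cong (_* ½ ^ j) (2^k*½^k k) ⟩
  1ℚ * ½ ^ j                  ≡⟨ *-identityˡ (½ ^ j) ⟩
  ½ ^ j                       ∎
  where open ≡-Reasoning

inv-double : ∀ x → inv^ (suc x ℕ.+ suc x) 1 ≡ ½ * inv^ (suc x) 1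
inv-double x = inverse-unique (inv-inverse (x ℕ.+ suc x)) (begin
  ½ * X * ℕ→ℚ (suc x ℕ.+ suc x)   ≡⟨ cong (½ * X *_) (ℕ→ℚ-+ (suc x) (suc x)) ⟩
  ½ * X * (M + M)                 ≡⟨ regroup ½ X M ⟩
  (½ * two) * (X * M)             ≡⟨ cong₂ _*_ (recip-inverse 2) (inv-inverse x) ⟩
  1ℚ * 1ℚ                         ≡⟨ *-identityˡ 1ℚ ⟩
  1ℚ                              ∎)
  where
  open ≡-Reasoning
  X = inv^ (suc x) 1
  M = ℕ→ℚ (suc x)
  regroup : ∀ h X M → (h * X) * (M + M) ≡ (h * two) * (X * M)
  regroup = solve-∀ ℚ-ring

sign-even : ∀ n → sign (n ℕ.+ n) ≡ 1ℚ
sign-even zero    = refl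
sign-even (suc n) = trans (cong (λ t → sign (suc t)) (ℕP.+-suc n n)) (sign-even n)

sign-odd : ∀ n → sign (n ℕ.+ suc n) ≡ - 1ℚ
sign-odd zero    = refl
sign-odd (suc n) = trans (cong sign (ℕP.+-suc (suc n) (suc n))) (sign-odd n)

-- Finite sums.  Σ1 N f = Σ_{x=1}^{N} f x comes from Defs; S n f = Σ_{j<n} f j indexes
-- the truncated power series that appear below.
S : ℕ → (ℕ → ℚ) → ℚ
S zero    f = 0ℚ
S (suc n) f = S n f + f n

+-interchange : ∀ a b c d → (a + b) + (c + d) ≡ (a + c) + (b + d)
+-interchange = solve-∀ ℚ-ring

Σ1-cong : ∀ N {f g} → (∀ x → x ℕ.< N → f (suc x) ≡ g (suc x)) → Σ1 N f ≡ Σ1 N g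
Σ1-cong zero    eq = refl
Σ1-cong (suc N) eq = cong₂ _+_ (Σ1-cong N (λ x lt → eq x (ℕP.m<n⇒m<1+n lt))) (eq N (ℕP.n<1+n N))

Σ1-+ : ∀ N f g → Σ1 N (λ x → f x + g x) ≡ Σ1 N f + Σ1 N g
Σ1-+ zero    f g = refl
Σ1-+ (suc N) f g = trans (cong (_+ (f (suc N) + g (suc N))) (Σ1-+ N f g))
                         (+-interchange (Σ1 N f) (Σ1 N g) (f (suc N)) (g (suc N)))

Σ1-*ˡ : ∀ N c f → Σ1 N (λ x → c * f x) ≡ c * Σ1 N f
Σ1-*ˡ zero    c f = sym (*-zeroʳ c)
Σ1-*ˡ (suc N) c f = trans (cong (_+ (c * f (suc N))) (Σ1-*ˡ N c f)) (sym (*-distribˡ-+ c (Σ1 N f) (f (suc N))))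

Σ1-neg : ∀ N f → Σ1 N (λ x → - f x) ≡ - Σ1 N f
Σ1-neg zero    f = refl
Σ1-neg (suc N) f = trans (cong (_+ (- f (suc N))) (Σ1-neg N f)) (sym (neg-distrib-+ (Σ1 N f) (f (suc N))))

S-cong : ∀ n {f g} → (∀ j → j ℕ.< n → f j ≡ g j) → S n f ≡ S n g
S-cong zero    eq = refl
S-cong (suc n) eq = cong₂ _+_ (S-cong n (λ j lt → eq j (ℕP.m<n⇒m<1+n lt))) (eq n (ℕP.n<1+n n))

S-+ : ∀ n f g → S n (λ j → f j + g j) ≡ S n f + S n g
S-+ zero    f g = sym (+-identityʳ 0ℚ)
S-+ (suc n) f g = trans (cong (_+ (f n + g n)) (S-+ n f g)) (+-interchange (S n f) (S n g) (f n) (g n))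

S-*ˡ : ∀ n c f → S n (λ j → c * f j) ≡ c * S n f
S-*ˡ zero    c f = sym (*-zeroʳ c)
S-*ˡ (suc n) c f = trans (cong (_+ (c * f n)) (S-*ˡ n c f)) (sym (*-distribˡ-+ c (S n f) (f n)))

S-*ʳ : ∀ n c f → S n (λ j → f j * c) ≡ S n f * c
S-*ʳ n c f = trans (S-cong n (λ j _ → *-comm (f j) c)) (trans (S-*ˡ n c f) (*-comm c (S n f)))

S-neg : ∀ n f → S n (λ j → - f j) ≡ - S n f
S-neg zero    f = refl
S-neg (suc n) f = trans (cong (_+ (- f n)) (S-neg n f)) (sym (neg-distrib-+ (S n f) (f n)))

S-zero : ∀ n f → (∀ j → j ℕ.< n → f j ≡ 0ℚ) → S n f ≡ 0ℚ
S-zero zero    f eq = refl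
S-zero (suc n) f eq = trans (cong₂ _+_ (S-zero n f (λ j lt → eq j (ℕP.m<n⇒m<1+n lt))) (eq n (ℕP.n<1+n n)))
                            (+-identityʳ 0ℚ)

S-first : ∀ n f → S (suc n) f ≡ f 0 + S n (λ j → f (suc j))
S-first zero    f = trans (+-identityˡ (f 0)) (sym (+-identityʳ (f 0)))
S-first (suc n) f = trans (cong (_+ f (suc n)) (S-first n f)) (+-assoc (f 0) _ _)

S-truncate : ∀ A C f → C ℕ.≤ A → (∀ j → C ℕ.≤ j → f j ≡ 0ℚ) → S A f ≡ S C f
S-truncate zero .zero f ℕ.z≤n vanish = refl
S-truncate (suc A) C f C≤1+A vanish with ℕP.m≤n⇒m<n∨m≡n C≤1+A
... | inj₂ refl = refl
... | inj₁ C<1+A = trans (cong (S A f +_) (vanish A (ℕP.≤-pred C<1+A)))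
                   (trans (+-identityʳ (S A f)) (S-truncate A C f (ℕP.≤-pred C<1+A) vanish))

Σ1-S : ∀ N n (g : ℕ → ℕ → ℚ) → Σ1 N (λ x → S n (g x)) ≡ S n (λ j → Σ1 N (λ x → g x j))
Σ1-S zero    n g = sym (S-zero n (λ _ → 0ℚ) (λ _ _ → refl))
Σ1-S (suc N) n g = trans (cong (_+ S n (g (suc N))) (Σ1-S N n g))
                         (sym (S-+ n (λ j → Σ1 N (λ x → g x j)) (g (suc N))))

S-S : ∀ N n (g : ℕ → ℕ → ℚ) → S N (λ x → S n (g x)) ≡ S n (λ j → S N (λ x → g x j))
S-S zero    n g = sym (S-zero n (λ _ → 0ℚ) (λ _ _ → refl))
S-S (suc N) n g = trans (cong (_+ S n (g N)) (S-S N n g)) (sym (S-+ n (λ j → S N (λ x → g x j)) (g N)))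

Σ1-series : ∀ N n c (a : ℕ → ℚ) (g : ℕ → ℕ → ℚ) →
  Σ1 N (λ x → c * S n (λ j → a j * g j x)) ≡ c * S n (λ j → a j * Σ1 N (g j))
Σ1-series N n c a g = trans (Σ1-*ˡ N c _) (cong (c *_)
  (trans (Σ1-S N n (λ x j → a j * g j x)) (S-cong n (λ j _ → Σ1-*ˡ N (a j) (g j)))))

Σ1-split : ∀ a b f → Σ1 (a ℕ.+ b) f ≡ Σ1 a f + Σ1 b (λ x → f (a ℕ.+ x))
Σ1-split a zero    f = trans (cong (λ t → Σ1 t f) (ℕP.+-identityʳ a)) (sym (+-identityʳ (Σ1 a f)))
Σ1-split a (suc b) f = trans (cong (λ t → Σ1 t f) (ℕP.+-suc a b))
  (trans (cong (_+ f (suc (a ℕ.+ b))) (Σ1-split a b f))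
  (trans (+-assoc (Σ1 a f) _ _) (cong (λ t → Σ1 a f + (Σ1 b (λ x → f (a ℕ.+ x)) + f t)) (sym (ℕP.+-suc a b)))))

Σ1-first : ∀ N f → Σ1 (suc N) f ≡ f 1 + Σ1 N (λ x → f (suc x))
Σ1-first zero    f = trans (+-identityˡ (f 1)) (sym (+-identityʳ (f 1)))
Σ1-first (suc N) f = trans (cong (_+ f (suc (suc N))) (Σ1-first N f)) (+-assoc (f 1) _ _)

Σ1-reverse : ∀ N f → Σ1 N f ≡ Σ1 N (λ x → f (suc N ℕ.∸ x))
Σ1-reverse zero    f = refl
Σ1-reverse (suc N) f = trans (cong (_+ f (suc N)) (Σ1-reverse N f))
  (trans (+-comm _ (f (suc N))) (sym (Σ1-first N (λ x → f (suc (suc N) ℕ.∸ x)))))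

Σ1-pairs : ∀ N f → Σ1 (N ℕ.+ N) f ≡ Σ1 N (λ x → f (x ℕ.+ x ℕ.∸ 1) + f (x ℕ.+ x))
Σ1-pairs zero    f = refl
Σ1-pairs (suc N) f = trans (cong (λ t → Σ1 t f) (cong suc (ℕP.+-suc N N)))
  (trans (+-assoc (Σ1 (N ℕ.+ N) f) (f (suc (N ℕ.+ N))) (f (suc (suc (N ℕ.+ N)))))
  (cong₂ _+_ (Σ1-pairs N f) (cong₂ (λ a b → f a + f b) (sym (ℕP.+-suc N N)) (cong suc (sym (ℕP.+-suc N N))))))

S-shift : ∀ (W : ℕ → ℚ) k n (a : ℕ → ℚ) →
  S (suc n) (λ j → a j * W (k ℕ.+ j)) ≡ a 0 * W k + S n (λ j → a (suc j) * W (suc k ℕ.+ j))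
S-shift W k n a = trans (S-first n (λ j → a j * W (k ℕ.+ j)))
  (cong₂ _+_ (cong (λ t → a 0 * W t) (ℕP.+-identityʳ k)) (S-cong n (λ j _ → cong (λ t → a (suc j) * W t) (ℕP.+-suc k j))))

S-two-terms : ∀ (W : ℕ → ℚ) k n (a : ℕ → ℚ) → S (2 ℕ.+ n) (λ j → a j * W (k ℕ.+ j)) ≡
  a 0 * W k + (a 1 * W (1 ℕ.+ k) + S n (λ j → a (2 ℕ.+ j) * W (2 ℕ.+ k ℕ.+ j)))
S-two-terms W k n a = trans (S-shift W k (suc n) a) (cong (a 0 * W k +_) (S-shift W (suc k) n (λ j → a (suc j))))

S-three-terms : ∀ (W : ℕ → ℚ) k n (a : ℕ → ℚ) → S (3 ℕ.+ n) (λ j → a j * W (k ℕ.+ j)) ≡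
  a 0 * W k + (a 1 * W (1 ℕ.+ k) + (a 2 * W (2 ℕ.+ k) + S n (λ j → a (3 ℕ.+ j) * W (3 ℕ.+ k ℕ.+ j))))
S-three-terms W k n a = trans (S-two-terms W k (suc n) a)
  (cong (λ t → a 0 * W k + (a 1 * W (1 ℕ.+ k) + t)) (S-shift W (2 ℕ.+ k) n (λ j → a (2 ℕ.+ j))))

-- For odd k the leading term W_k of the series cancels: w + (-1)^k·(1·w + R) = -R.
leading-cancels : ∀ {s c} → s ≡ - 1ℚ → c ≡ 1ℚ → ∀ w R → w + s * (c * w + R) ≡ - R
leading-cancels refl refl = cancel
  where
  cancel : ∀ w R → w + - 1ℚ * (1ℚ * w + R) ≡ - R
  cancel = solve-∀ ℚ-ring

S-neg-scale : ∀ n ρ (a w : ℕ → ℚ) → - (ρ * S n (λ j → a j * w j)) ≡ S n (λ j → (- (ρ * a j)) * w j)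
S-neg-scale n ρ a w = trans (cong -_ (sym (S-*ˡ n ρ _))) (trans (sym (S-neg n _))
  (S-cong n (λ j _ → regroup ρ (a j) (w j))))
  where
  regroup : ∀ ρ a w → - (ρ * (a * w)) ≡ (- (ρ * a)) * w
  regroup = solve-∀ ℚ-ring

-- For a prime p we work in the local
-- ring ℤ_(p) of rationals whose reduced denominator is prime to p:
-- x ≈ y [mod n ] means x - y = p^n·z with z p-integral.

module Modulo (p : ℕ) (p-prime : Prime p) where

  instance
    p≢0 : ℕ.NonZero p
    p≢0 = prime⇒nonZero p-prime

  p∤1 : ¬ (p ∣ 1)
  p∤1 p∣1 = ℕP.<⇒≢ (ℕ.nonTrivial⇒n>1 p {{prime⇒nonTrivial p-prime}}) (sym (ℕD.∣1⇒≡1 p∣1))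

  p∤* : ∀ {m n} → ¬ (p ∣ m) → ¬ (p ∣ n) → ¬ (p ∣ m ℕ.* n)
  p∤* {m} {n} p∤m p∤n p∣mn with euclidsLemma m n p-prime p∣mn
  ... | inj₁ p∣m = p∤m p∣m
  ... | inj₂ p∣n = p∤n p∣n

  p∤^ : ∀ {a} k → ¬ (p ∣ a) → ¬ (p ∣ a ℕ.^ k)
  p∤^ zero    p∤a = p∤1
  p∤^ (suc k) p∤a = p∤* p∤a (p∤^ k p∤a)

  ∣-abs : ∀ {a b : ℤ} {c : ℤ} → a ℤ.* c ≡ b → ℤ.∣ a ∣ ∣ ℤ.∣ b ∣
  ∣-abs {a} {b} {c} ac≡b = divides ℤ.∣ c ∣
    (trans (cong ℤ.∣_∣ (sym ac≡b)) (trans (ℤP.abs-* a c) (ℕP.*-comm ℤ.∣ a ∣ ℤ.∣ c ∣)))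

  record Integral (x : ℚ) : Set where
    constructor integral
    field p∤den : ¬ (p ∣ ↧ₙ x)

  -- Sums and products of p-integral numbers are p-integral, since the reduced
  -- denominator of the result divides the product of the two denominators.
  integral-den : ∀ {a b c} (k : ℤ) → ↧ c ℤ.* k ≡ ↧ a ℤ.* ↧ b → Integral a → Integral b → Integral c
  integral-den {a} {b} {c} k eq (integral p∤a) (integral p∤b) = integral λ p∣c →
    p∤* p∤a p∤b (subst (p ∣_) (ℤP.abs-* (↧ a) (↧ b)) (ℕD.∣-trans p∣c (∣-abs {a = ↧ c} eq)))

  integral-+ : ∀ {a b} → Integral a → Integral b → Integral (a + b)
  integral-+ {a} {b} = integral-den _ (↧-+ a b)

  integral-* : ∀ {a b} → Integral a → Integral b → Integral (a * b)
  integral-* {a} {b} = integral-den _ (↧-* a b)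

  integral-neg : ∀ {a} → Integral a → Integral (- a)
  integral-neg {a} (integral p∤a) = integral λ p∣ → p∤a (subst (p ∣_) (cong ℤ.∣_∣ (↧-neg a)) p∣)

  integral-ℕ : ∀ n → Integral (ℕ→ℚ n)
  integral-ℕ n = integral λ p∣ → p∤1 (subst (p ∣_) (ℤP.+-injective (↧-ℕ→ℚ n)) p∣)

  integral-^ : ∀ {x} k → Integral x → Integral (x ^ k)
  integral-^ zero    ix = integral-ℕ 1
  integral-^ (suc k) ix = integral-* ix (integral-^ k ix)

  integral-recip : ∀ N .{{_ : ℕ.NonZero N}} → ¬ (p ∣ N) → Integral (⁺ 1 / N)
  integral-recip N p∤N = integral λ p∣ → p∤N (ℕD.∣-trans p∣ (∣-abs {a = ↧ (⁺ 1 / N)} (↧-/ (⁺ 1) N)))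

  integral-recip-< : ∀ N → 1 ≤ N → N ℕ.< p → Integral (recip N)
  integral-recip-< (suc N) _ N<p = integral-recip (suc N) (λ p∣N → ℕP.<⇒≱ N<p (ℕD.∣⇒≤ p∣N))

  integral-inv^ : ∀ m k → suc m ℕ.< p → Integral (inv^ (suc m) k)
  integral-inv^ m k m<p = integral-recip (suc m ℕ.^ k) {{ℕP.m^n≢0 (suc m) k}}
    (p∤^ k λ p∣m → ℕP.<⇒≱ m<p (ℕD.∣⇒≤ p∣m))

  p^ : ℕ → ℚ
  p^ n = ℕ→ℚ (p ℕ.^ n)

  p^-+ : ∀ m n → p^ (m ℕ.+ n) ≡ p^ m * p^ n
  p^-+ m n = trans (cong ℕ→ℚ (ℕP.^-distribˡ-+-* p m n)) (ℕ→ℚ-* (p ℕ.^ m) (p ℕ.^ n))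

  record Divisible (n : ℕ) (x : ℚ) : Set where
    constructor divisible
    field
      cofactor    : ℚ
      integral-cofactor : Integral cofactor
      factorised  : x ≡ p^ n * cofactor

  divisible-≡ : ∀ {n x y} → x ≡ y → Divisible n x → Divisible n y
  divisible-≡ refl dx = dx

  divisible-0 : ∀ n → Divisible n 0ℚ
  divisible-0 n = divisible 0ℚ (integral-ℕ 0) (sym (*-zeroʳ (p^ n)))

  divisible-+ : ∀ {n x y} → Divisible n x → Divisible n y → Divisible n (x + y)
  divisible-+ {n} (divisible a ia refl) (divisible b ib refl) =
    divisible (a + b) (integral-+ ia ib) (sym (*-distribˡ-+ (p^ n) a b))

  divisible-neg : ∀ {n x} → Divisible n x → Divisible n (- x)
  divisible-neg {n} (divisible a ia refl) = divisible (- a) (integral-neg ia) (neg-distribʳ-* (p^ n) a)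

  divisible-*ˡ : ∀ {n x} c → Integral c → Divisible n x → Divisible n (c * x)
  divisible-*ˡ {n} c ic (divisible a ia refl) = divisible (c * a) (integral-* ic ia) (reorder c (p^ n) a)
    where
    reorder : ∀ c q a → c * (q * a) ≡ q * (c * a)
    reorder = solve-∀ ℚ-ring

  divisible-* : ∀ {m n x y} → Divisible m x → Divisible n y → Divisible (m ℕ.+ n) (x * y)
  divisible-* {m} {n} (divisible a ia refl) (divisible b ib refl) = divisible (a * b) (integral-* ia ib)
    (trans (reorder (p^ m) a (p^ n) b) (cong (_* (a * b)) (sym (p^-+ m n))))
    where
    reorder : ∀ u v w z → (u * v) * (w * z) ≡ (u * w) * (v * z)
    reorder = solve-∀ ℚ-ring

  integral⇒divisible : ∀ {x} → Integral x → Divisible 0 x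
  integral⇒divisible {x} ix = divisible x ix (sym (*-identityˡ x))

  divisible⇒integral : ∀ {n x} → Divisible n x → Integral x
  divisible⇒integral {n} (divisible a ia refl) = integral-* (integral-ℕ (p ℕ.^ n)) ia

  divisible-mono : ∀ {m n x} → n ≤ m → Divisible m x → Divisible n x
  divisible-mono {m} {n} n≤m (divisible a ia refl) =
    divisible (p^ (m ℕ.∸ n) * a) (integral-* (integral-ℕ (p ℕ.^ (m ℕ.∸ n))) ia)
      (trans (cong (_* a) (trans (cong p^ (sym (ℕP.m+[n∸m]≡n n≤m)) ) (p^-+ n (m ℕ.∸ n)))) (*-assoc (p^ n) _ a))

  divisible-^ : ∀ {u} n → Divisible 1 u → Divisible n (u ^ n)
  divisible-^ zero    du = integral⇒divisible (integral-ℕ 1)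
  divisible-^ (suc n) du = divisible-* du (divisible-^ n du)

  Σ1-divisible : ∀ {n} N {f} → (∀ x → x ℕ.< N → Divisible n (f (suc x))) → Divisible n (Σ1 N f)
  Σ1-divisible {n} zero    df = divisible-0 n
  Σ1-divisible (suc N) df = divisible-+ (Σ1-divisible N (λ x lt → df x (ℕP.m<n⇒m<1+n lt))) (df N (ℕP.n<1+n N))

  ratio-divisible : ∀ x → suc x ℕ.< p → Divisible 1 (ratio p (suc x))
  ratio-divisible x x<p = divisible (inv^ (suc x) 1) (integral-inv^ x 1 x<p)
                                    (cong (λ t → ℕ→ℚ t * inv^ (suc x) 1) (sym (ℕP.*-identityʳ p)))

  infix 4 _≈_[mod_]
  record _≈_[mod_] (x y : ℚ) (n : ℕ) : Set where
    constructor congruent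
    field difference : Divisible n (x - y)

  ≈-refl : ∀ {n} x → x ≈ x [mod n ]
  ≈-refl {n} x = congruent (divisible-≡ (sym (+-inverseʳ x)) (divisible-0 n))

  ≡⇒≈ : ∀ {n x y} → x ≡ y → x ≈ y [mod n ]
  ≡⇒≈ {x = x} refl = ≈-refl x

  ≈-sym : ∀ {n x y} → x ≈ y [mod n ] → y ≈ x [mod n ]
  ≈-sym {n} {x} {y} (congruent d) = congruent (divisible-≡ (negate x y) (divisible-neg d))
    where
    negate : ∀ x y → - (x - y) ≡ y - x
    negate = solve-∀ ℚ-ring

  ≈-trans : ∀ {n x y z} → x ≈ y [mod n ] → y ≈ z [mod n ] → x ≈ z [mod n ]
  ≈-trans {n} {x} {y} {z} (congruent d) (congruent e) = congruent (divisible-≡ (telescope x y z) (divisible-+ d e))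
    where
    telescope : ∀ x y z → (x - y) + (y - z) ≡ x - z
    telescope = solve-∀ ℚ-ring

  ≈-+ : ∀ {n x x' y y'} → x ≈ x' [mod n ] → y ≈ y' [mod n ] → x + y ≈ x' + y' [mod n ]
  ≈-+ {n} {x} {x'} {y} {y'} (congruent d) (congruent e) = congruent (divisible-≡ (regroup x x' y y') (divisible-+ d e))
    where
    regroup : ∀ x x' y y' → (x - x') + (y - y') ≡ (x + y) - (x' + y')
    regroup = solve-∀ ℚ-ring

  ≈-neg : ∀ {n x y} → x ≈ y [mod n ] → - x ≈ - y [mod n ] 
  ≈-neg {n} {x} {y} (congruent d) = congruent (divisible-≡ (neg-distrib-+ x (- y)) (divisible-neg d))

  ≈-*ˡ : ∀ {n x y} c → Integral c → x ≈ y [mod n ] → c * x ≈ c * y [mod n ]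
  ≈-*ˡ {n} {x} {y} c ic (congruent d) = congruent (divisible-≡ (distrib c x y) (divisible-*ˡ c ic d))
    where
    distrib : ∀ c x y → c * (x - y) ≡ c * x - c * y
    distrib = solve-∀ ℚ-ring

  ≈-mono : ∀ {m n x y} → n ≤ m → x ≈ y [mod m ] → x ≈ y [mod n ]
  ≈-mono n≤m (congruent d) = congruent (divisible-mono n≤m d)

  ≈-mod-1 : ∀ {x y} → Integral x → Integral y → x ≈ y [mod 0 ]
  ≈-mod-1 ix iy = congruent (integral⇒divisible (integral-+ ix (integral-neg iy)))

  divisible⇒≈0 : ∀ {n x} → Divisible n x → x ≈ 0ℚ [mod n ]
  divisible⇒≈0 {n} {x} d = congruent (divisible-≡ (sym (minus-0 x)) d)
    where
    minus-0 : ∀ x → x - 0ℚ ≡ x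
    minus-0 = solve-∀ ℚ-ring

  Σ1-≈ : ∀ {n} N {f g} → (∀ x → x ℕ.< N → f (suc x) ≈ g (suc x) [mod n ]) → Σ1 N f ≈ Σ1 N g [mod n ]
  Σ1-≈ zero    fg = ≈-refl 0ℚ
  Σ1-≈ (suc N) fg = ≈-+ (Σ1-≈ N (λ x lt → fg x (ℕP.m<n⇒m<1+n lt))) (fg N (ℕP.n<1+n N))

  S-≈ : ∀ {n} N {f g} → (∀ j → j ℕ.< N → f j ≈ g j [mod n ]) → S N f ≈ S N g [mod n ]
  S-≈ zero    fg = ≈-refl 0ℚ
  S-≈ (suc N) fg = ≈-+ (S-≈ N (λ j lt → fg j (ℕP.m<n⇒m<1+n lt))) (fg N (ℕP.n<1+n N))

  isolate : ∀ {n X Y L β ρ} → X ≈ β * Y + L [mod n ] → ρ * β ≡ 1ℚ → Integral ρ →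
            Y ≈ ρ * X - ρ * L [mod n ]
  isolate {n} {X} {Y} {L} {β} {ρ} X≈ ρβ≡1 iρ =
    ≈-trans (≡⇒≈ solved) (≈-+ (≈-*ˡ ρ iρ (≈-sym X≈)) (≈-refl (- (ρ * L))))
    where
    expand : ∀ ρ β Y L → (ρ * β) * Y ≡ ρ * (β * Y + L) - ρ * L
    expand = solve-∀ ℚ-ring
    solved : Y ≡ ρ * (β * Y + L) - ρ * L
    solved = trans (sym (*-identityˡ Y)) (trans (cong (_* Y) (sym ρβ≡1)) (expand ρ β Y L))

  p^∣-cancel : ∀ n {A g} → ¬ (p ∣ g) → (p ℕ.^ n) ∣ A ℕ.* g → (p ℕ.^ n) ∣ A
  p^∣-cancel zero    {A} _ _ = ℕD.1∣ A
  p^∣-cancel (suc n) {A} {g} p∤g p^n∣Ag with euclidsLemma A g p-prime (ℕD.∣-trans (ℕD.m∣m*n (p ℕ.^ n)) p^n∣Ag)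
  ... | inj₂ p∣g = ⊥-elim (p∤g p∣g)
  ... | inj₁ (divides q refl) =
    subst (λ t → p ℕ.* p ℕ.^ n ∣ t) (ℕP.*-comm p q)
      (ℕD.*-monoʳ-∣ p (p^∣-cancel n p∤g (ℕD.*-cancelˡ-∣ p (subst (λ t → p ℕ.* p ℕ.^ n ∣ t) (regroup q) p^n∣Ag))))
    where
    regroup : ∀ q → q ℕ.* p ℕ.* g ≡ p ℕ.* (q ℕ.* g)
    regroup q = trans (cong (ℕ._* g) (ℕP.*-comm q p)) (ℕP.*-assoc p q g)

  -- A number x = p^n·a with a p-integral has p-adic valuation at least n in the sense
  -- of Defs: reducing the fraction p^n·a only cancels a factor c, which is prime to p.
  reduced-ValGe : ∀ n x a {c : ℤ} → ↥ x ℤ.* c ≡ ↥ (p^ n) ℤ.* ↥ a → ↧ x ℤ.* c ≡ ↧ (p^ n) ℤ.* ↧ a →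
                  ¬ (p ∣ ↧ₙ a) → ValGe p n x
  reduced-ValGe n x a {c} num-eq den-eq p∤a = p^n∣num , p∤den
    where
    den : ↧ₙ x ℕ.* ℤ.∣ c ∣ ≡ ↧ₙ a
    den = trans (sym (ℤP.abs-* (↧ x) c)) (trans (cong ℤ.∣_∣ den-eq)
            (trans (cong (λ t → ℤ.∣ t ℤ.* ↧ a ∣) (↧-ℕ→ℚ (p ℕ.^ n))) (cong ℤ.∣_∣ (ℤP.*-identityˡ (↧ a)))))
    num : ℤ.∣ ↥ x ∣ ℕ.* ℤ.∣ c ∣ ≡ p ℕ.^ n ℕ.* ℤ.∣ ↥ a ∣
    num = trans (sym (ℤP.abs-* (↥ x) c)) (trans (cong ℤ.∣_∣ num-eq)
            (trans (cong (λ t → ℤ.∣ t ℤ.* ↥ a ∣) (↥-ℕ→ℚ (p ℕ.^ n))) (ℤP.abs-* (⁺ (p ℕ.^ n)) (↥ a))))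
    p∤c : ¬ (p ∣ ℤ.∣ c ∣)
    p∤c p∣c = p∤a (ℕD.∣-trans p∣c (divides (↧ₙ x) (sym den)))
    p∤den : ¬ (p ∣ ↧ₙ x)
    p∤den p∣ = p∤a (ℕD.∣-trans p∣ (divides (ℤ.∣ c ∣) (trans (sym den) (ℕP.*-comm (↧ₙ x) _))))
    p^n∣num : (p ℕ.^ n) ∣ ℤ.∣ ↥ x ∣
    p^n∣num = p^∣-cancel n p∤c (subst (p ℕ.^ n ∣_) (sym num) (ℕD.m∣m*n _))

  divisible⇒ValGe : ∀ {n x} → Divisible n x → ValGe p n x
  divisible⇒ValGe {n} (divisible a (integral p∤a) refl) =
    reduced-ValGe n (p^ n * a) a (↥-* (p^ n) a) (↧-* (p^ n) a) p∤a

  ≈⇒CongMod : ∀ {n x y} → x ≈ y [mod n ] → CongMod p n x y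
  ≈⇒CongMod (congruent d) = divisible⇒ValGe d

-- The binomial series (1 - u)^{-k} = Σ_j C(k+j-1, j) u^j.  Its coefficients
-- multichoose k j = C(k+j-1, j) are defined by Pascal's rule.
multichoose : ℕ → ℕ → ℕ
multichoose zero    zero    = 1
multichoose zero    (suc j) = 0
multichoose (suc k) zero    = multichoose k zero
multichoose (suc k) (suc j) = multichoose (suc k) j ℕ.+ multichoose k (suc j)

mcℚ : ℕ → ℕ → ℚ
mcℚ k j = ℕ→ℚ (multichoose k j)

multichoose-0 : ∀ k → multichoose k 0 ≡ 1
multichoose-0 zero    = refl
multichoose-0 (suc k) = multichoose-0 k

-- The coefficients inverted when solving for W_{k+1} and W_{k+2} (k odd) are positive.
multichoose-1-pos : ∀ k → 1 ≤ multichoose (suc k) 1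
multichoose-1-pos k = subst (1 ≤_) (cong (ℕ._+ multichoose k 1) (sym (multichoose-0 k))) (ℕ.s≤s ℕ.z≤n)

multichoose-2-pos : ∀ k → 1 ≤ multichoose (suc k) 2
multichoose-2-pos k = ℕP.≤-trans (multichoose-1-pos k) (ℕP.m≤m+n (multichoose (suc k) 1) (multichoose k 2))

series : ℚ → ℕ → ℕ → ℚ
series u k n = S n (λ j → mcℚ k j * u ^ j)

series-0 : ∀ u n → series u 0 (suc n) ≡ 1ℚ
series-0 u zero    = refl
series-0 u (suc n) = trans (cong (_+ (0ℚ * u ^ suc n)) (series-0 u n))
                           (trans (cong (1ℚ +_) (*-zeroˡ (u ^ suc n))) (+-identityʳ 1ℚ))

-- Telescoping by Pascal's rule: multiplying the series for k+1 by (1 - u) gives the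
-- series for k up to the single boundary term C(k+n, n)·u^{n+1}.
series-telescope : ∀ u k n → (1ℚ - u) * series u (suc k) (suc n) ≡ series u k (suc n) - mcℚ (suc k) n * u ^ suc n
series-telescope u k zero = base (mcℚ k 0) u
  where
  base : ∀ C u → (1ℚ - u) * (0ℚ + C * 1ℚ) ≡ (0ℚ + C * 1ℚ) - C * (u * 1ℚ)
  base = solve-∀ ℚ-ring
series-telescope u k (suc n) = begin
  (1ℚ - u) * (series u (suc k) (suc n) + mcℚ (suc k) (suc n) * u ^ suc n)
    ≡⟨ cong (λ t → (1ℚ - u) * (series u (suc k) (suc n) + t * u ^ suc n)) pascal ⟩
  (1ℚ - u) * (A + (c + c₀) * U)
    ≡⟨ expand u A c c₀ U ⟩
  (1ℚ - u) * A + ((c + c₀) * U - (c + c₀) * (u * U))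
    ≡⟨ cong (_+ ((c + c₀) * U - (c + c₀) * (u * U))) (series-telescope u k n) ⟩
  (B - c * U) + ((c + c₀) * U - (c + c₀) * (u * U))
    ≡⟨ collect B c c₀ U u ⟩
  (B + c₀ * U) - (c + c₀) * (u * U)
    ≡⟨ cong (λ t → (B + c₀ * U) - t * (u * U)) (sym pascal) ⟩
  series u k (suc (suc n)) - mcℚ (suc k) (suc n) * u ^ suc (suc n) ∎
  where
  open ≡-Reasoning
  A = series u (suc k) (suc n)
  B = series u k (suc n)
  U = u ^ suc n
  c = mcℚ (suc k) n
  c₀ = mcℚ k (suc n)
  pascal : mcℚ (suc k) (suc n) ≡ c + c₀
  pascal = ℕ→ℚ-+ (multichoose (suc k) n) (multichoose k (suc n))
  expand : ∀ u A c c₀ U → (1ℚ - u) * (A + (c + c₀) * U) ≡ (1ℚ - u) * A + ((c + c₀) * U - (c + c₀) * (u * U))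
  expand = solve-∀ ℚ-ring
  collect : ∀ B c c₀ U u → (B - c * U) + ((c + c₀) * U - (c + c₀) * (u * U)) ≡ (B + c₀ * U) - (c + c₀) * (u * U)
  collect = solve-∀ ℚ-ring

module Expansions (p : ℕ) (p-prime : Prime p) where
  open Modulo p p-prime

  integral-series : ∀ {u} k n → Integral u → Integral (series u k n)
  integral-series {u} k zero    iu = integral-ℕ 0
  integral-series {u} k (suc n) iu =
    integral-+ (integral-series k n iu) (integral-* (integral-ℕ (multichoose k n)) (integral-^ n iu))

  geometric : ∀ {Z u} → Z * (1ℚ - u) ≡ 1ℚ → Integral Z → Divisible 1 u →
              ∀ k n → Z ^ k ≈ series u k n [mod n ]
  geometric {Z} {u} Z-inv iZ du = go
    where
    iu = divisible⇒integral du
    go : ∀ k n → Z ^ k ≈ series u k n [mod n ]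
    go k       zero    = ≈-mod-1 (integral-^ k iZ) (integral-series k 0 iu)
    go zero    (suc n) = ≡⇒≈ (sym (series-0 u n))
    go (suc k) (suc n) = ≈-trans (≈-*ˡ Z iZ (go k (suc n))) boundary
      where
      A = series u k (suc n)
      U = mcℚ (suc k) n * u ^ suc n
      next : series u (suc k) (suc n) ≡ Z * (A - U)
      next = begin
        series u (suc k) (suc n)                  ≡⟨ sym (*-identityˡ _) ⟩
        1ℚ * series u (suc k) (suc n)             ≡⟨ cong (_* series u (suc k) (suc n)) (sym Z-inv) ⟩
        Z * (1ℚ - u) * series u (suc k) (suc n)   ≡⟨ *-assoc Z (1ℚ - u) _ ⟩
        Z * ((1ℚ - u) * series u (suc k) (suc n)) ≡⟨ cong (Z *_) (series-telescope u k n) ⟩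
        Z * (A - U)                               ∎
        where open ≡-Reasoning
      ZU-divisible : Divisible (suc n) (Z * U)
      ZU-divisible = divisible-≡ (*-assoc Z (mcℚ (suc k) n) (u ^ suc n))
        (divisible-*ˡ (Z * mcℚ (suc k) n) (integral-* iZ (integral-ℕ (multichoose (suc k) n)))
                      (divisible-^ (suc n) du))
      split : ∀ Z A U → Z * U ≡ Z * A - Z * (A - U)
      split = solve-∀ ℚ-ring
      boundary : Z * A ≈ series u (suc k) (suc n) [mod suc n ]
      boundary = congruent (divisible-≡ (trans (split Z A U) (cong (λ t → Z * A - t) (sym next))) ZU-divisible)

  -- The reflection x ↦ p - x: for m + r = p with 0 < m, r,
  --   (p/r)^k ≡ (-1)^k Σ_{j<n} C(k+j-1, j) (p/m)^{k+j}  (mod p^n),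
  -- obtained from p/r = -(p/m)·Z with Z = -m/r = (1 - p/m)^{-1}.
  reflection : ∀ m r → suc m ℕ.+ suc r ≡ p → ∀ k n →
    ratio p (suc r) ^ k ≈ (- 1ℚ) ^ k * S n (λ j → mcℚ k j * ratio p (suc m) ^ (k ℕ.+ j)) [mod n ]
  reflection m r m+r≡p k n = ≈-trans (≡⇒≈ factor)
    (≈-trans (≈-*ˡ ((- 1ℚ) ^ k) (integral-^ k (integral-neg (integral-ℕ 1)))
               (≈-*ˡ (u ^ k) (integral-^ k (divisible⇒integral du)) (geometric Z-inv iZ du k n)))
    (≡⇒≈ (cong ((- 1ℚ) ^ k *_) shift)))
    where
    M = ℕ→ℚ (suc m)
    R = ℕ→ℚ (suc r)
    X = inv^ (suc m) 1
    Y = inv^ (suc r) 1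
    u = ratio p (suc m)
    V = ratio p (suc r)
    Z = - (M * Y)
    p≡M+R : ℕ→ℚ p ≡ M + R
    p≡M+R = trans (cong ℕ→ℚ (sym m+r≡p)) (ℕ→ℚ-+ (suc m) (suc r))
    r<p : suc r ℕ.< p
    r<p = subst (suc r ℕ.<_) (trans (ℕP.+-comm (suc r) (suc m)) m+r≡p) (ℕP.m<m+n (suc r) (ℕ.s≤s ℕ.z≤n))
    iZ : Integral Z
    iZ = integral-neg (integral-* (integral-ℕ (suc m)) (integral-inv^ r 1 r<p))
    du : Divisible 1 u
    du = ratio-divisible m (subst (suc m ℕ.<_) m+r≡p (ℕP.m<m+n (suc m) (ℕ.s≤s ℕ.z≤n)))
    Z-inv : Z * (1ℚ - u) ≡ 1ℚ
    Z-inv = begin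
      Z * (1ℚ - ℕ→ℚ p * X)                            ≡⟨ cong (λ t → Z * (1ℚ - t * X)) p≡M+R ⟩
      - (M * Y) * (1ℚ - (M + R) * X)                  ≡⟨ expand M R X Y ⟩
      - (M * Y) + (X * M) * (Y * M) + (X * M) * (Y * R) ≡⟨ cong₂ (λ a b → - (M * Y) + a * (Y * M) + a * b) (inv-inverse m) (inv-inverse r) ⟩
      - (M * Y) + 1ℚ * (Y * M) + 1ℚ * 1ℚ              ≡⟨ cancel M Y ⟩
      1ℚ                                              ∎
      where
      open ≡-Reasoning
      expand : ∀ M R X Y → - (M * Y) * (1ℚ - (M + R) * X) ≡ - (M * Y) + (X * M) * (Y * M) + (X * M) * (Y * R)
      expand = solve-∀ ℚ-ring
      cancel : ∀ M Y → - (M * Y) + 1ℚ * (Y * M) + 1ℚ * 1ℚ ≡ 1ℚ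
      cancel = solve-∀ ℚ-ring
    V≡-uZ : V ≡ (- 1ℚ) * (u * Z)
    V≡-uZ = begin
      ℕ→ℚ p * Y                         ≡⟨ cong (_* Y) p≡M+R ⟩
      (M + R) * Y                       ≡⟨ sym (*-identityˡ _) ⟩
      1ℚ * ((M + R) * Y)                ≡⟨ cong (_* ((M + R) * Y)) (sym (inv-inverse m)) ⟩
      (X * M) * ((M + R) * Y)           ≡⟨ regroup M R X Y ⟩
      (- 1ℚ) * ((M + R) * X * Z)        ≡⟨ cong (λ t → (- 1ℚ) * (t * X * Z)) (sym p≡M+R) ⟩
      (- 1ℚ) * (u * Z)                  ∎
      where
      open ≡-Reasoning
      regroup : ∀ M R X Y → (X * M) * ((M + R) * Y) ≡ (- 1ℚ) * ((M + R) * X * - (M * Y))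
      regroup = solve-∀ ℚ-ring
    factor : V ^ k ≡ (- 1ℚ) ^ k * (u ^ k * Z ^ k)
    factor = trans (cong (_^ k) V≡-uZ)
      (trans (^-distrib-* (- 1ℚ) (u * Z) k) (cong ((- 1ℚ) ^ k *_) (^-distrib-* u Z k)))
    shift : u ^ k * series u k n ≡ S n (λ j → mcℚ k j * u ^ (k ℕ.+ j))
    shift = trans (sym (S-*ˡ n (u ^ k) (λ j → mcℚ k j * u ^ j)))
      (S-cong n (λ j _ → trans (swap (u ^ k) (mcℚ k j) (u ^ j)) (cong (mcℚ k j *_) (sym (^-homo-* u k j)))))
      where
      swap : ∀ a b c → a * (b * c) ≡ b * (a * c)
      swap = solve-∀ ℚ-ring

-- Coefficients of the two recursions (k odd, see solve-W₁ and solve-W₂):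
--   W_{k+1} ≡ γ₁ k·h_p(k) + Σ_j δ₁ k j·W_{k+2+j},  W_{k+2} ≡ γ₂ k·h_p(k) + Σ_j δ₂ k j·W_{k+3+j}.
-- Here ρ₂ k inverts the coefficient -½·C(k+1, 2) of W_{k+2} in eliminate-W₁, and ε₂ k j
-- are the coefficients of the higher W's there.
γ₁ : ℕ → ℚ
γ₁ k = - recip (multichoose k 1)

δ₁ : ℕ → ℕ → ℚ
δ₁ k j = - (γ₁ k * - mcℚ k (2 ℕ.+ j))

ρ₂ : ℕ → ℚ
ρ₂ k = - (two * recip (multichoose k 2))

γ₂ : ℕ → ℚ
γ₂ k = ρ₂ k * (1ℚ - two * two ^ k)

ε₂ : ℕ → ℕ → ℚ
ε₂ k j = two * (mcℚ k (3 ℕ.+ j) * ½ ^ (3 ℕ.+ j)) - mcℚ k (3 ℕ.+ j)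

δ₂ : ℕ → ℕ → ℚ
δ₂ k j = - (ρ₂ k * ε₂ k j)

-- Every m = q + 2 ≥ 2 is written m = k + t with k odd and t ∈ {1, 2}; W_m is then
-- obtained from the first (t = 1) or the second (t = 2) recursion at k.
data Gap : Set where
  gap₁ gap₂ : Gap

size : Gap → ℕ
size gap₁ = 1
size gap₂ = 2

gap : ℕ → Gap
gap zero          = gap₁
gap (suc zero)    = gap₂
gap (suc (suc q)) = gap q

evenPart : ℕ → ℕ
evenPart zero          = 0
evenPart (suc zero)    = 0
evenPart (suc (suc q)) = suc (suc (evenPart q))

oddIndex : ℕ → ℕ
oddIndex q = suc (evenPart q)

size+oddIndex : ∀ q → size (gap q) ℕ.+ oddIndex q ≡ suc (suc q)
size+oddIndex zero          = refl
size+oddIndex (suc zero)    = refl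
size+oddIndex (suc (suc q)) = trans (ℕP.+-suc (size (gap q)) (suc (suc (evenPart q))))
                              (trans (cong suc (ℕP.+-suc (size (gap q)) (suc (evenPart q))))
                                     (cong (λ t → suc (suc t)) (size+oddIndex q)))

oddIndex-odd : ∀ q → (- 1ℚ) ^ oddIndex q ≡ - 1ℚ
oddIndex-odd zero          = refl
oddIndex-odd (suc zero)    = refl
oddIndex-odd (suc (suc q)) = trans (square-cancels ((- 1ℚ) ^ oddIndex q)) (oddIndex-odd q)
  where
  square-cancels : ∀ a → - 1ℚ * (- 1ℚ * a) ≡ a
  square-cancels = solve-∀ ℚ-ring

-- q < k + 2, so h_k only enters the expansions of W_m with m < k + 3.
q≤oddIndex : ∀ q → q ≤ oddIndex q
q≤oddIndex zero          = ℕ.z≤n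
q≤oddIndex (suc zero)    = ℕ.s≤s ℕ.z≤n
q≤oddIndex (suc (suc q)) = ℕ.s≤s (ℕ.s≤s (q≤oddIndex q))

-- The pivot C(k+t-1, t) that is inverted when solving for W_{k+t}; it is positive.
pivot : ℕ → ℕ
pivot q = multichoose (oddIndex q) (size (gap q))

pivot-pos : ∀ q → 1 ≤ pivot q
pivot-pos q with gap q
... | gap₁ = multichoose-1-pos (evenPart q)
... | gap₂ = multichoose-2-pos (evenPart q)

γ : Gap → ℕ → ℚ
γ gap₁ = γ₁
γ gap₂ = γ₂

δ : Gap → ℕ → ℕ → ℚ
δ gap₁ = δ₁
δ gap₂ = δ₂

γq : ℕ → ℚ
γq q = γ (gap q) (oddIndex q)

δq : ℕ → ℕ → ℚ
δq q = δ (gap q) (oddIndex q)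

-- The expansion coefficients: W_m ≡ Σ_i d m i · h_p(i).  Unfolding the recursion for
-- W_{q+2} gives d (q+2) i = γq q·[i = k] + Σ_j δq q j · d (q+3+j) i, and d m i = 0 once
-- m ≥ i + 3; so only j < i terms matter and the recursion terminates.  It is computed
-- with explicit fuel, 3 + i being always enough (D-fuel).
kronecker : ℕ → ℕ → ℚ
kronecker i k with i ℕ.≟ k
... | yes _ = 1ℚ
... | no _  = 0ℚ

kronecker-≢ : ∀ i k → ¬ (i ≡ k) → kronecker i k ≡ 0ℚ
kronecker-≢ i k i≢k with i ℕ.≟ k
... | yes i≡k = ⊥-elim (i≢k i≡k)
... | no _    = refl

kronecker-≡ : ∀ i → kronecker i i ≡ 1ℚ
kronecker-≡ i with i ℕ.≟ i
... | yes _   = refl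
... | no i≢i = ⊥-elim (i≢i refl)

S-kronecker-≥ : ∀ n k (g : ℕ → ℚ) → n ≤ k → S n (λ i → kronecker i k * g i) ≡ 0ℚ
S-kronecker-≥ n k g n≤k = S-zero n _ (λ i i<n →
  trans (cong (_* g i) (kronecker-≢ i k (λ i≡k → ℕP.<⇒≢ (ℕP.<-≤-trans i<n n≤k) i≡k))) (*-zeroˡ (g i)))

S-kronecker-< : ∀ n k (g : ℕ → ℚ) → k ℕ.< n → S n (λ i → kronecker i k * g i) ≡ g k
S-kronecker-< (suc n) k g k<1+n with k ℕ.≟ n
... | yes refl = trans (cong₂ _+_ (S-kronecker-≥ k k g ℕP.≤-refl) (trans (cong (_* g k) (kronecker-≡ k)) (*-identityˡ (g k))))
                       (+-identityˡ (g k))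
... | no k≢n = trans (cong₂ _+_ (S-kronecker-< n k g (ℕP.≤-pred (ℕP.≤∧≢⇒< k<1+n (λ e → k≢n (ℕP.suc-injective e)))))
                                 (trans (cong (_* g n) (kronecker-≢ n k (λ e → k≢n (sym e)))) (*-zeroˡ (g n))))
                     (+-identityʳ (g k))

D : ℕ → ℕ → ℕ → ℚ
D zero    m             i = 0ℚ
D (suc f) zero          i = 0ℚ
D (suc f) (suc zero)    i = 0ℚ
D (suc f) (suc (suc q)) i = γq q * kronecker i (oddIndex q) + S (3 ℕ.+ i) (λ j → δq q j * D f (3 ℕ.+ q ℕ.+ j) i)

d : ℕ → ℕ → ℚ
d m i = D (3 ℕ.+ i) m i

D-vanish : ∀ f m i → 3 ℕ.+ i ≤ m → D f m i ≡ 0ℚ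
D-vanish zero    m             i i+3≤m = refl
D-vanish (suc f) (suc zero)    i (ℕ.s≤s ())
D-vanish (suc f) (suc (suc q)) i i+3≤m = trans (cong₂ _+_
    (trans (cong (γq q *_) (kronecker-≢ i (oddIndex q) i≢k)) (*-zeroʳ (γq q)))
    (S-zero (3 ℕ.+ i) _ (λ j _ → trans (cong (δq q j *_)
      (D-vanish f (3 ℕ.+ q ℕ.+ j) i (ℕP.≤-trans (ℕP.m≤n⇒m≤1+n i+3≤m) (ℕP.m≤m+n _ j)))) (*-zeroʳ (δq q j)))))
  (+-identityʳ 0ℚ)
  where
  i≢k : ¬ (i ≡ oddIndex q)
  i≢k i≡k = ℕP.<⇒≢ (ℕP.≤-trans (ℕP.≤-pred (ℕP.≤-pred i+3≤m)) (q≤oddIndex q)) i≡k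

d-vanish : ∀ m i → 3 ℕ.+ i ≤ m → d m i ≡ 0ℚ
d-vanish m i = D-vanish (3 ℕ.+ i) m i

D-fuel : ∀ f f' m i → (3 ℕ.+ i) ℕ.∸ m ≤ f → (3 ℕ.+ i) ℕ.∸ m ≤ f' → D f m i ≡ D f' m i
D-fuel zero    f'       m i b b' = sym (D-vanish f' m i (ℕP.m∸n≡0⇒m≤n (ℕP.n≤0⇒n≡0 b)))
D-fuel (suc f) zero     m i b b' = D-vanish (suc f) m i (ℕP.m∸n≡0⇒m≤n (ℕP.n≤0⇒n≡0 b'))
D-fuel (suc f) (suc f') zero          i b b' = refl
D-fuel (suc f) (suc f') (suc zero)    i b b' = refl
D-fuel (suc f) (suc f') (suc (suc q)) i b b' =
  cong (γq q * kronecker i (oddIndex q) +_) (S-cong (3 ℕ.+ i) (λ j _ →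
    cong (δq q j *_) (D-fuel f f' (3 ℕ.+ q ℕ.+ j) i (enough f b j) (enough f' b' j))))
  where
  enough : ∀ g → (3 ℕ.+ i) ℕ.∸ suc (suc q) ≤ suc g → ∀ j → (3 ℕ.+ i) ℕ.∸ (3 ℕ.+ q ℕ.+ j) ≤ g
  enough g b j = ℕP.≤-trans (ℕP.∸-monoʳ-≤ (3 ℕ.+ i) (ℕP.m≤m+n (3 ℕ.+ q) j))
                   (subst (_≤ g) (ℕP.pred[m∸n]≡m∸[1+n] (3 ℕ.+ i) (suc (suc q))) (ℕP.pred-mono-≤ b))

d-unfold : ∀ q i → d (2 ℕ.+ q) i ≡ γq q * kronecker i (oddIndex q) + S (3 ℕ.+ i) (λ j → δq q j * d (3 ℕ.+ q ℕ.+ j) i)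
d-unfold q i = cong (γq q * kronecker i (oddIndex q) +_) (S-cong (3 ℕ.+ i) (λ j _ → cong (δq q j *_)
  (D-fuel (2 ℕ.+ i) (3 ℕ.+ i) (3 ℕ.+ q ℕ.+ j) i
    (ℕP.∸-monoʳ-≤ (3 ℕ.+ i) (ℕ.s≤s (ℕ.z≤n {suc (suc q) ℕ.+ j}))) (ℕP.m∸n≤m (3 ℕ.+ i) (3 ℕ.+ q ℕ.+ j)))))

d-at-0 : ∀ q → d (2 ℕ.+ q) 0 ≡ 0ℚ
d-at-0 q = trans (d-unfold q 0) (trans (cong₂ _+_
    (trans (cong (γq q *_) (kronecker-≢ 0 (oddIndex q) (λ ()))) (*-zeroʳ (γq q)))
    (S-zero 3 _ (λ j _ → trans (cong (δq q j *_) (d-vanish (3 ℕ.+ q ℕ.+ j) 0 (ℕ.s≤s (ℕ.s≤s (ℕ.s≤s ℕ.z≤n)))))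
                               (*-zeroʳ (δq q j)))))
  (+-identityʳ 0ℚ))

-- The depth-one compositions (i + 1), and the coefficients of the alternating sum
-- 2·2^{-k} W_k - h_p(k) in terms of the h_p(i).
single : ℕ → Composition
single i = suc i ∷ []

altCoeff : ℕ → ℕ → ℚ
altCoeff k i = two * (½ ^ k * d k i) - kronecker i k

altCoeff-at-0 : ∀ q → altCoeff (2 ℕ.+ q) 0 ≡ 0ℚ
altCoeff-at-0 q = trans (cong₂ (λ a b → two * (½ ^ (2 ℕ.+ q) * a) - b) (d-at-0 q) (kronecker-≢ 0 (2 ℕ.+ q) (λ ())))
                        (vanish (½ ^ (2 ℕ.+ q)))
  where
  vanish : ∀ a → two * (a * 0ℚ) - 0ℚ ≡ 0ℚ
  vanish = solve-∀ ℚ-ring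

module OddPrime (half : ℕ) (p-prime : Prime (suc (half ℕ.+ half))) where

  p : ℕ
  p = suc (half ℕ.+ half)

  open Modulo p p-prime
  open Expansions p p-prime

  term : ℕ → ℕ → ℚ
  term k x = ratio p x ^ k

  W : ℕ → ℚ
  W k = Σ1 half (term k)

  hk : ℕ → ℚ
  hk k = h p (k ∷ [])

  -- Every term p/x with 0 < x < p lies in pℤ_(p), so W_k, h_p(k) ∈ p^k ℤ_(p).
  W-divisible : ∀ k → Divisible k (W k)
  W-divisible k = Σ1-divisible half (λ x x<half →
    divisible-^ k (ratio-divisible x (ℕ.s≤s (ℕP.≤-trans x<half (ℕP.m≤m+n half half)))))

  hk-sum : ∀ k → hk k ≡ Σ1 (half ℕ.+ half) (term k)
  hk-sum k = trans (sym (Σ1-*ˡ (half ℕ.+ half) (ℕ→ℚ (p ℕ.^ (k ℕ.+ 0))) (λ n → inv^ n k * 1ℚ)))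
    (Σ1-cong (half ℕ.+ half) (λ x _ → begin
      ℕ→ℚ (p ℕ.^ (k ℕ.+ 0)) * (inv^ (suc x) k * 1ℚ) ≡⟨ cong (ℕ→ℚ (p ℕ.^ (k ℕ.+ 0)) *_) (*-identityʳ _) ⟩
      ℕ→ℚ (p ℕ.^ (k ℕ.+ 0)) * inv^ (suc x) k        ≡⟨ cong (λ t → ℕ→ℚ (p ℕ.^ t) * inv^ (suc x) k) (ℕP.+-identityʳ k) ⟩
      ℕ→ℚ (p ℕ.^ k) * inv^ (suc x) k                ≡⟨ ratio-power p x k ⟩
      term k (suc x)                               ∎))
    where open ≡-Reasoning

  hk-divisible : ∀ k → Divisible k (hk k)
  hk-divisible k = divisible-≡ (sym (hk-sum k))
    (Σ1-divisible (half ℕ.+ half) (λ x x<2half → divisible-^ k (ratio-divisible x (ℕ.s≤s x<2half))))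

  halfSum≡W : ∀ k → halfSum k p ≡ W k
  halfSum≡W k = trans (cong (λ t → ℕ→ℚ (p ℕ.^ k) * Σ1 t (λ n → inv^ n k)) half-index)
    (trans (sym (Σ1-*ˡ half (ℕ→ℚ (p ℕ.^ k)) (λ n → inv^ n k))) (Σ1-cong half (λ x _ → ratio-power p x k)))
    where
    half-index : (half ℕ.+ half) ℕ./ 2 ≡ half
    half-index = trans (cong (ℕ._/ 2) (double half)) (ℕDM.m*n/n≡m half 2)
      where
      double : ∀ h → h ℕ.+ h ≡ h ℕ.* 2
      double = ℕSolver.solve-∀

  ratio-double : ∀ x → ratio p (suc x ℕ.+ suc x) ≡ ½ * ratio p (suc x)
  ratio-double x = trans (cong (ℕ→ℚ p *_) (inv-double x)) (swap (ℕ→ℚ p) ½ (inv^ (suc x) 1))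
    where
    swap : ∀ a b c → a * (b * c) ≡ b * (a * c)
    swap = solve-∀ ℚ-ring

  even-terms : ∀ k → Σ1 half (λ x → term k (x ℕ.+ x)) ≡ ½ ^ k * W k
  even-terms k = trans (Σ1-cong half (λ x _ → trans (cong (_^ k) (ratio-double x)) (^-distrib-* ½ (ratio p (suc x)) k)))
                       (Σ1-*ˡ half (½ ^ k) (term k))

  -- First fundamental congruence: reflecting the terms x > (p-1)/2 of h_p(k) to p - x,
  --   h_p(k) ≡ W_k + (-1)^k Σ_{j<n} C(k+j-1, j) W_{k+j}  (mod p^n).
  reflect-upper : ∀ k n → hk k ≈ W k + (- 1ℚ) ^ k * S n (λ j → mcℚ k j * W (k ℕ.+ j)) [mod n ]
  reflect-upper k n = ≈-trans (≡⇒≈ split) (≈-trans (≈-+ (≈-refl (W k)) (Σ1-≈ half reflected)) (≡⇒≈ collect))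
    where
    split : hk k ≡ W k + Σ1 half (λ x → term k (half ℕ.+ (suc half ℕ.∸ x)))
    split = trans (hk-sum k) (trans (Σ1-split half half (term k))
                                    (cong (W k +_) (Σ1-reverse half (λ y → term k (half ℕ.+ y)))))
    reflected : ∀ x → x ℕ.< half →
      term k (half ℕ.+ (half ℕ.∸ x)) ≈ (- 1ℚ) ^ k * S n (λ j → mcℚ k j * term (k ℕ.+ j) (suc x)) [mod n ]
    reflected x x<half with ℕP.m≤n⇒∃[o]m+o≡n x<half
    ... | a , x+1+a≡half = ≈-trans (≡⇒≈ (cong (term k) index)) (reflection x (half ℕ.+ a) complement k n)
      where
      index : half ℕ.+ (half ℕ.∸ x) ≡ suc (half ℕ.+ a)
      index = trans (cong (half ℕ.+_) (trans (cong (ℕ._∸ x) (trans (sym x+1+a≡half) (sym (ℕP.+-suc x a))))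
                                             (ℕP.m+n∸m≡n x (suc a))))
                    (ℕP.+-suc half a)
      complement : suc x ℕ.+ suc (half ℕ.+ a) ≡ p
      complement = trans (arith x a half) (cong (λ t → suc (half ℕ.+ t)) x+1+a≡half)
        where
        arith : ∀ x a h → suc x ℕ.+ suc (h ℕ.+ a) ≡ suc (h ℕ.+ (suc x ℕ.+ a))
        arith = ℕSolver.solve-∀
    collect : W k + Σ1 half (λ x → (- 1ℚ) ^ k * S n (λ j → mcℚ k j * term (k ℕ.+ j) x))
              ≡ W k + (- 1ℚ) ^ k * S n (λ j → mcℚ k j * W (k ℕ.+ j))
    collect = cong (W k +_) (Σ1-series half n ((- 1ℚ) ^ k) (mcℚ k) (λ j → term (k ℕ.+ j)))

  -- Second fundamental congruence: the even terms 2x of h_p(k) give 2^{-k} W_k, and the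
  -- odd terms p - 2x, reflected, expand in powers of p/(2x) = ½·(p/x):
  --   h_p(k) ≡ (-1)^k Σ_{j<n} C(k+j-1, j) 2^{-k-j} W_{k+j} + 2^{-k} W_k  (mod p^n).
  reflect-odd : ∀ k n →
    hk k ≈ (- 1ℚ) ^ k * S n (λ j → (mcℚ k j * ½ ^ (k ℕ.+ j)) * W (k ℕ.+ j)) + ½ ^ k * W k [mod n ]
  reflect-odd k n = ≈-trans (≡⇒≈ split) (≈-+ (≈-trans (Σ1-≈ half reflected)
    (≡⇒≈ (Σ1-series half n ((- 1ℚ) ^ k) a (λ j → term (k ℕ.+ j))))) (≈-refl (½ ^ k * W k)))
    where
    a : ℕ → ℚ
    a j = mcℚ k j * ½ ^ (k ℕ.+ j)
    split : hk k ≡ Σ1 half (λ x → term k ((suc half ℕ.∸ x) ℕ.+ (suc half ℕ.∸ x) ℕ.∸ 1)) + ½ ^ k * W k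
    split = trans (hk-sum k) (trans (Σ1-pairs half (term k)) (trans (Σ1-+ half _ _)
              (cong₂ _+_ (Σ1-reverse half (λ x → term k (x ℕ.+ x ℕ.∸ 1))) (even-terms k))))
    reflected : ∀ x → x ℕ.< half →
      term k ((half ℕ.∸ x) ℕ.+ (half ℕ.∸ x) ℕ.∸ 1) ≈ (- 1ℚ) ^ k * S n (λ j → a j * term (k ℕ.+ j) (suc x)) [mod n ]
    reflected x x<half with ℕP.m≤n⇒∃[o]m+o≡n x<half
    ... | b , x+1+b≡half = ≈-trans (≡⇒≈ (cong (term k) index))
      (≈-trans (reflection (x ℕ.+ suc x) (b ℕ.+ b) complement k n) (≡⇒≈ (cong ((- 1ℚ) ^ k *_) (S-cong n halve))))
      where
      half∸x : half ℕ.∸ x ≡ suc b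
      half∸x = trans (cong (ℕ._∸ x) (trans (sym x+1+b≡half) (sym (ℕP.+-suc x b)))) (ℕP.m+n∸m≡n x (suc b))
      index : (half ℕ.∸ x) ℕ.+ (half ℕ.∸ x) ℕ.∸ 1 ≡ suc (b ℕ.+ b)
      index = trans (cong (λ t → t ℕ.+ t ℕ.∸ 1) half∸x) (ℕP.+-suc b b)
      complement : suc (x ℕ.+ suc x) ℕ.+ suc (b ℕ.+ b) ≡ p
      complement = trans (arith x b) (cong (λ t → suc (t ℕ.+ t)) x+1+b≡half)
        where
        arith : ∀ x b → suc (x ℕ.+ suc x) ℕ.+ suc (b ℕ.+ b) ≡ suc ((suc x ℕ.+ b) ℕ.+ (suc x ℕ.+ b))
        arith = ℕSolver.solve-∀
      halve : ∀ j → j ℕ.< n → mcℚ k j * ratio p (suc x ℕ.+ suc x) ^ (k ℕ.+ j) ≡ a j * term (k ℕ.+ j) (suc x)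
      halve j _ = trans (cong (λ t → mcℚ k j * t ^ (k ℕ.+ j)) (ratio-double x))
        (trans (cong (mcℚ k j *_) (^-distrib-* ½ (ratio p (suc x)) (k ℕ.+ j)))
               (sym (*-assoc (mcℚ k j) (½ ^ (k ℕ.+ j)) (term (k ℕ.+ j) (suc x)))))

  reflect-odd-scaled : ∀ k n →
    two ^ k * hk k ≈ W k + (- 1ℚ) ^ k * S n (λ j → (mcℚ k j * ½ ^ j) * W (k ℕ.+ j)) [mod n ]
  reflect-odd-scaled k n = ≈-trans (≈-*ˡ (two ^ k) (integral-^ k (integral-ℕ 2)) (reflect-odd k n)) (≡⇒≈ (begin
    two ^ k * ((- 1ℚ) ^ k * A + ½ ^ k * W k)
      ≡⟨ distribute (two ^ k) ((- 1ℚ) ^ k) A (½ ^ k) (W k) ⟩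
    (two ^ k * ½ ^ k) * W k + (- 1ℚ) ^ k * (two ^ k * A)
      ≡⟨ cong₂ (λ u v → u * W k + (- 1ℚ) ^ k * v) (2^k*½^k k) (sym (S-*ˡ n (two ^ k) _)) ⟩
    1ℚ * W k + (- 1ℚ) ^ k * S n (λ j → two ^ k * ((mcℚ k j * ½ ^ (k ℕ.+ j)) * W (k ℕ.+ j)))
      ≡⟨ cong₂ (λ u v → u + (- 1ℚ) ^ k * v) (*-identityˡ (W k)) (S-cong n (λ j _ → absorb j)) ⟩
    W k + (- 1ℚ) ^ k * S n (λ j → (mcℚ k j * ½ ^ j) * W (k ℕ.+ j)) ∎))
    where
    open ≡-Reasoning
    A = S n (λ j → (mcℚ k j * ½ ^ (k ℕ.+ j)) * W (k ℕ.+ j))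
    distribute : ∀ t s A h w → t * (s * A + h * w) ≡ (t * h) * w + s * (t * A)
    distribute = solve-∀ ℚ-ring
    regroup : ∀ t c h w → t * ((c * h) * w) ≡ (c * (t * h)) * w
    regroup = solve-∀ ℚ-ring
    absorb : ∀ j → two ^ k * ((mcℚ k j * ½ ^ (k ℕ.+ j)) * W (k ℕ.+ j)) ≡ (mcℚ k j * ½ ^ j) * W (k ℕ.+ j)
    absorb j = trans (regroup (two ^ k) (mcℚ k j) (½ ^ (k ℕ.+ j)) (W (k ℕ.+ j)))
                     (cong (λ t → (mcℚ k j * t) * W (k ℕ.+ j)) (2^k*½^[k+j] k j))

  -- The alternating sum: odd terms count negatively, so it is twice the even part minus h_p(k).
  altSum≡ : ∀ k → altSum k p ≡ two * (½ ^ k * W k) - hk k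
  altSum≡ k = begin
    altSum k p
      ≡⟨ sym (Σ1-*ˡ (half ℕ.+ half) (ℕ→ℚ (p ℕ.^ k)) (λ n → sign n * inv^ n k)) ⟩
    Σ1 (half ℕ.+ half) (λ n → ℕ→ℚ (p ℕ.^ k) * (sign n * inv^ n k))
      ≡⟨ Σ1-cong (half ℕ.+ half) (λ x _ → trans (swap (ℕ→ℚ (p ℕ.^ k)) (sign (suc x)) (inv^ (suc x) k))
                                                (cong (sign (suc x) *_) (ratio-power p x k))) ⟩
    Σ1 (half ℕ.+ half) (λ n → sign n * term k n)
      ≡⟨ Σ1-pairs half (λ n → sign n * term k n) ⟩
    Σ1 half (λ x → sign (x ℕ.+ x ℕ.∸ 1) * term k (x ℕ.+ x ℕ.∸ 1) + sign (x ℕ.+ x) * term k (x ℕ.+ x))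
      ≡⟨ Σ1-cong half (λ x _ → cong₂ _+_ (cong (_* term k (x ℕ.+ suc x)) (sign-odd x))
                                         (cong (_* term k (suc x ℕ.+ suc x)) (sign-even (suc x)))) ⟩
    Σ1 half (λ x → - 1ℚ * odd x + 1ℚ * even x)
      ≡⟨ Σ1-cong half (λ x _ → rearrange (odd (suc x)) (even (suc x))) ⟩
    Σ1 half (λ x → two * even x - (odd x + even x))
      ≡⟨ trans (Σ1-+ half _ _) (cong₂ _+_ (Σ1-*ˡ half two even) (Σ1-neg half (λ x → odd x + even x))) ⟩
    two * Σ1 half even - Σ1 half (λ x → odd x + even x)
      ≡⟨ cong₂ (λ u v → two * u - v) (even-terms k) (sym (trans (hk-sum k) (Σ1-pairs half (term k)))) ⟩
    two * (½ ^ k * W k) - hk k ∎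
    where
    open ≡-Reasoning
    odd even : ℕ → ℚ
    odd x = term k (x ℕ.+ x ℕ.∸ 1)
    even x = term k (x ℕ.+ x)
    swap : ∀ a b c → a * (b * c) ≡ b * (a * c)
    swap = solve-∀ ℚ-ring
    rearrange : ∀ o e → - 1ℚ * o + 1ℚ * e ≡ two * e - (o + e)
    rearrange = solve-∀ ℚ-ring

  -- For odd k the terms W_k cancel in both fundamental
  -- congruences; reflect-upper then determines W_{k+1}, and the combination
  -- reflect-upper - 2·reflect-odd, in which W_{k+1} cancels as well, determines W_{k+2},
  -- in both cases from h_p(k) and W_{k+3}, W_{k+4}, ….
  solve-W₁ : ∀ k n → (- 1ℚ) ^ k ≡ - 1ℚ → 1 ≤ multichoose k 1 → Integral (recip (multichoose k 1)) →
    W (1 ℕ.+ k) ≈ γ₁ k * hk k + S n (λ j → δ₁ k j * W (2 ℕ.+ k ℕ.+ j)) [mod n ]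
  solve-W₁ k n odd c₁≥1 i-recip = ≈-mono (ℕP.m≤n+m n 2)
    (≈-trans (isolate hk≈ inverse (integral-neg i-recip)) (≡⇒≈ (cong (γ₁ k * hk k +_) (S-neg-scale n (γ₁ k) _ _))))
    where
    c₁ = mcℚ k 1
    W₁ = W (1 ℕ.+ k)
    L = S n (λ j → mcℚ k (2 ℕ.+ j) * W (2 ℕ.+ k ℕ.+ j))
    hk≈ : hk k ≈ (- c₁) * W₁ + S n (λ j → (- mcℚ k (2 ℕ.+ j)) * W (2 ℕ.+ k ℕ.+ j)) [mod 2 ℕ.+ n ]
    hk≈ = ≈-trans (reflect-upper k (2 ℕ.+ n)) (≡⇒≈ (begin
      W k + (- 1ℚ) ^ k * S (2 ℕ.+ n) (λ j → mcℚ k j * W (k ℕ.+ j))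
        ≡⟨ cong (λ t → W k + (- 1ℚ) ^ k * t) (S-two-terms W k n (mcℚ k)) ⟩
      W k + (- 1ℚ) ^ k * (mcℚ k 0 * W k + (c₁ * W₁ + L))
        ≡⟨ leading-cancels odd (cong ℕ→ℚ (multichoose-0 k)) (W k) (c₁ * W₁ + L) ⟩
      - (c₁ * W₁ + L)
        ≡⟨ split c₁ W₁ L ⟩
      (- c₁) * W₁ + - L
        ≡⟨ cong ((- c₁) * W₁ +_) (sym (S-neg n _)) ⟩
      (- c₁) * W₁ + S n (λ j → - (mcℚ k (2 ℕ.+ j) * W (2 ℕ.+ k ℕ.+ j)))
        ≡⟨ cong ((- c₁) * W₁ +_) (S-cong n (λ j _ → neg-distribˡ-* (mcℚ k (2 ℕ.+ j)) _)) ⟩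
      (- c₁) * W₁ + S n (λ j → (- mcℚ k (2 ℕ.+ j)) * W (2 ℕ.+ k ℕ.+ j)) ∎))
      where
      open ≡-Reasoning
      split : ∀ c w L → - (c * w + L) ≡ (- c) * w + - L
      split = solve-∀ ℚ-ring
    inverse : γ₁ k * (- c₁) ≡ 1ℚ
    inverse = trans (neg-neg (recip (multichoose k 1)) c₁) (recip-inverse′ (multichoose k 1) c₁≥1)
      where
      neg-neg : ∀ r c → (- r) * (- c) ≡ r * c
      neg-neg = solve-∀ ℚ-ring

  -- reflect-upper - 2·reflect-odd-scaled: both W_k and W_{k+1} cancel (using 2·½ = 1), leaving
  --   (1 - 2^{k+1}) h_p(k) ≡ -(½·C(k+1,2)) W_{k+2} + Σ_{j<n} ε₂ k j · W_{k+3+j}  (mod p^{n+3}).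
  eliminate-W₁ : ∀ k n → (- 1ℚ) ^ k ≡ - 1ℚ →
    hk k - two * (two ^ k * hk k) ≈ (- (½ * mcℚ k 2)) * W (2 ℕ.+ k) + S n (λ j → ε₂ k j * W (3 ℕ.+ k ℕ.+ j)) [mod 3 ℕ.+ n ]
  eliminate-W₁ k n odd = ≈-trans (≈-+ upper (≈-neg (≈-*ˡ two (integral-ℕ 2) lower)))
    (≡⇒≈ (trans (eliminate ½ c₁ c₂ W₁ W₂ L₁ L₂)
      (trans (no-error _ (c₁ * W₁ + (½ + 1ℚ) * (c₂ * W₂))) (cong ((- (½ * c₂)) * W₂ +_) L-combined))))
    where
    c₁ = mcℚ k 1
    c₂ = mcℚ k 2
    W₁ = W (1 ℕ.+ k)
    W₂ = W (2 ℕ.+ k)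
    e : ℕ → ℚ
    e j = mcℚ k (3 ℕ.+ j)
    w : ℕ → ℚ
    w j = W (3 ℕ.+ k ℕ.+ j)
    L₁ = S n (λ j → e j * w j)
    L₂ = S n (λ j → (e j * ½ ^ (3 ℕ.+ j)) * w j)
    upper : hk k ≈ - (c₁ * W₁ + (c₂ * W₂ + L₁)) [mod 3 ℕ.+ n ]
    upper = ≈-trans (reflect-upper k (3 ℕ.+ n)) (≡⇒≈ (trans
      (cong (λ t → W k + (- 1ℚ) ^ k * t) (S-three-terms W k n (mcℚ k)))
      (leading-cancels odd (cong ℕ→ℚ (multichoose-0 k)) (W k) _)))
    lower : two ^ k * hk k ≈ - ((c₁ * ½ ^ 1) * W₁ + ((c₂ * ½ ^ 2) * W₂ + L₂)) [mod 3 ℕ.+ n ]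
    lower = ≈-trans (reflect-odd-scaled k (3 ℕ.+ n)) (≡⇒≈ (trans
      (cong (λ t → W k + (- 1ℚ) ^ k * t) (S-three-terms W k n (λ j → mcℚ k j * ½ ^ j)))
      (leading-cancels odd (trans (*-identityʳ (mcℚ k 0)) (cong ℕ→ℚ (multichoose-0 k))) (W k) _)))
    -- With t = ½ the error term (2t - 1)(…) vanishes, eliminating W₁.
    eliminate : ∀ t c₁ c₂ W₁ W₂ L₁ L₂ →
      - (c₁ * W₁ + (c₂ * W₂ + L₁)) - two * - ((c₁ * (t * 1ℚ)) * W₁ + ((c₂ * (t * (t * 1ℚ))) * W₂ + L₂))
      ≡ ((- (t * c₂)) * W₂ + (two * L₂ - L₁)) + (two * t - 1ℚ) * (c₁ * W₁ + (t + 1ℚ) * (c₂ * W₂))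
    eliminate = solve-∀ ℚ-ring
    no-error : ∀ x y → x + (two * ½ - 1ℚ) * y ≡ x
    no-error x y = trans (cong (λ t → x + (t - 1ℚ) * y) two*½)
      (trans (cong (λ t → x + t * y) (+-inverseʳ 1ℚ)) (trans (cong (x +_) (*-zeroˡ y)) (+-identityʳ x)))
    L-combined : two * L₂ - L₁ ≡ S n (λ j → ε₂ k j * w j)
    L-combined = sym (trans (S-cong n (λ j _ → distrib two (e j * ½ ^ (3 ℕ.+ j)) (e j) (w j)))
      (trans (S-+ n _ _) (cong₂ _+_ (S-*ˡ n two _) (S-neg n _))))
      where
      distrib : ∀ t u v w → (t * u - v) * w ≡ t * (u * w) + - (v * w)
      distrib = solve-∀ ℚ-ring

  solve-W₂ : ∀ k n → (- 1ℚ) ^ k ≡ - 1ℚ → 1 ≤ multichoose k 2 → Integral (recip (multichoose k 2)) →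
    W (2 ℕ.+ k) ≈ γ₂ k * hk k + S n (λ j → δ₂ k j * W (3 ℕ.+ k ℕ.+ j)) [mod n ]
  solve-W₂ k n odd c₂≥1 i-recip = ≈-mono (ℕP.m≤n+m n 3)
    (≈-trans (isolate (eliminate-W₁ k n odd) inverse (integral-neg (integral-* (integral-ℕ 2) i-recip)))
             (≡⇒≈ (cong₂ _+_ (factor (ρ₂ k) (two ^ k) (hk k)) (S-neg-scale n (ρ₂ k) (ε₂ k) _))))
    where
    inverse : ρ₂ k * (- (½ * mcℚ k 2)) ≡ 1ℚ
    inverse = trans (regroup (recip (multichoose k 2)) (mcℚ k 2))
      (trans (cong₂ _*_ two*½ (recip-inverse′ (multichoose k 2) c₂≥1)) (*-identityˡ 1ℚ))
      where
      regroup : ∀ r c → (- (two * r)) * (- (½ * c)) ≡ (two * ½) * (r * c)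
      regroup = solve-∀ ℚ-ring
    factor : ∀ ρ q h → ρ * (h - two * (q * h)) ≡ (ρ * (1ℚ - two * q)) * h
    factor = solve-∀ ℚ-ring

  solve-W : ∀ q n → Integral (recip (pivot q)) →
    W (2 ℕ.+ q) ≈ γq q * hk (oddIndex q) + S n (λ j → δq q j * W (3 ℕ.+ q ℕ.+ j)) [mod n ]
  solve-W q n i-recip = by-gap (gap q) (size+oddIndex q) (pivot-pos q) i-recip
    where
    k = oddIndex q
    by-gap : ∀ g → size g ℕ.+ k ≡ 2 ℕ.+ q → 1 ≤ multichoose k (size g) → Integral (recip (multichoose k (size g))) →
      W (2 ℕ.+ q) ≈ γ g k * hk k + S n (λ j → δ g k j * W (3 ℕ.+ q ℕ.+ j)) [mod n ]
    by-gap gap₁ eq pos i = subst (λ m → W m ≈ γ₁ k * hk k + S n (λ j → δ₁ k j * W (suc m ℕ.+ j)) [mod n ]) eq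
                                 (solve-W₁ k n (oddIndex-odd q) pos i)
    by-gap gap₂ eq pos i = subst (λ m → W m ≈ γ₂ k * hk k + S n (λ j → δ₂ k j * W (suc m ℕ.+ j)) [mod n ]) eq
                                 (solve-W₂ k n (oddIndex-odd q) pos i)

  integral-γq : ∀ q → Integral (recip (pivot q)) → Integral (γq q)
  integral-γq q = by-gap (gap q)
    where
    k = oddIndex q
    by-gap : ∀ g → Integral (recip (multichoose k (size g))) → Integral (γ g k)
    by-gap gap₁ i = integral-neg i
    by-gap gap₂ i = integral-* (integral-neg (integral-* (integral-ℕ 2) i))
                               (integral-+ (integral-ℕ 1) (integral-neg (integral-* (integral-ℕ 2) (integral-^ k (integral-ℕ 2)))))

  integral-δq : ∀ q j → Integral (recip (pivot q)) → Integral ½ → Integral (δq q j)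
  integral-δq q j i-recip i½ = by-gap (gap q) i-recip
    where
    k = oddIndex q
    by-gap : ∀ g → Integral (recip (multichoose k (size g))) → Integral (δ g k j)
    by-gap gap₁ i = integral-neg (integral-* (integral-neg i) (integral-neg (integral-ℕ (multichoose k (2 ℕ.+ j)))))
    by-gap gap₂ i = integral-neg (integral-* (integral-neg (integral-* (integral-ℕ 2) i))
      (integral-+ (integral-* (integral-ℕ 2) (integral-* (integral-ℕ (multichoose k (3 ℕ.+ j))) (integral-^ (3 ℕ.+ j) i½)))
                  (integral-neg (integral-ℕ (multichoose k (3 ℕ.+ j))))))

  combination : ℕ → (ℕ → ℚ) → ℚ
  combination n v = S n (λ i → v i * hk i)

  -- h_p(k) itself is such a combination modulo p^n (for k ≥ n both sides vanish).
  hk≈combination : ∀ n k → hk k ≈ combination n (λ i → kronecker i k) [mod n ]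
  hk≈combination n k with k ℕ.<? n
  ... | yes k<n = ≡⇒≈ (sym (S-kronecker-< n k hk k<n))
  ... | no k≮n  = ≈-trans (divisible⇒≈0 (divisible-mono (ℕP.≮⇒≥ k≮n) (hk-divisible k)))
                          (≡⇒≈ (sym (S-kronecker-≥ n k hk (ℕP.≮⇒≥ k≮n))))

  -- Beyond the truncation both W_m and its expansion vanish modulo p^n.
  expansion-beyond : ∀ n m → 3 ℕ.+ n ≤ m → W m ≈ combination n (d m) [mod n ]
  expansion-beyond n m n+3≤m = ≈-trans (divisible⇒≈0 (divisible-mono (ℕP.≤-trans (ℕP.m≤n+m n 3) n+3≤m) (W-divisible m)))
    (≡⇒≈ (sym (S-zero n _ (λ i i<n →
      trans (cong (_* hk i) (d-vanish m i (ℕP.≤-trans (ℕP.+-monoʳ-≤ 3 (ℕP.<⇒≤ i<n)) n+3≤m))) (*-zeroˡ (hk i))))))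

  combination-unfold : ∀ n q → combination n (d (2 ℕ.+ q)) ≡
    γq q * combination n (λ i → kronecker i (oddIndex q)) + S n (λ j → δq q j * combination n (d (3 ℕ.+ q ℕ.+ j)))
  combination-unfold n q = begin
    S n (λ i → d (2 ℕ.+ q) i * hk i)
      ≡⟨ S-cong n (λ i i<n → cong (_* hk i) (trans (d-unfold q i) (cong (γq q * kronecker i k +_) (truncate i i<n)))) ⟩
    S n (λ i → (γq q * kronecker i k + S n (F i)) * hk i)
      ≡⟨ S-cong n (λ i _ → distrib (γq q) (kronecker i k) (S n (F i)) (hk i)) ⟩
    S n (λ i → γq q * (kronecker i k * hk i) + S n (F i) * hk i)
      ≡⟨ S-+ n _ _ ⟩
    S n (λ i → γq q * (kronecker i k * hk i)) + S n (λ i → S n (F i) * hk i)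
      ≡⟨ cong₂ _+_ (S-*ˡ n (γq q) _) interchange ⟩
    γq q * combination n (λ i → kronecker i k) + S n (λ j → δq q j * combination n (d (3 ℕ.+ q ℕ.+ j))) ∎
    where
    open ≡-Reasoning
    k = oddIndex q
    F : ℕ → ℕ → ℚ
    F i j = δq q j * d (3 ℕ.+ q ℕ.+ j) i
    -- Terms with j ≥ i vanish, so the inner sum may run over j < n for every i < n.
    truncate : ∀ i → i ℕ.< n → S (3 ℕ.+ i) (F i) ≡ S n (F i)
    truncate i i<n = trans (S-truncate (3 ℕ.+ i) i (F i) (ℕP.m≤n+m i 3) vanish)
                           (sym (S-truncate n i (F i) (ℕP.<⇒≤ i<n) vanish))
      where
      vanish : ∀ j → i ≤ j → F i j ≡ 0ℚ
      vanish j i≤j = trans (cong (δq q j *_) (d-vanish (3 ℕ.+ q ℕ.+ j) i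
        (ℕ.s≤s (ℕ.s≤s (ℕ.s≤s (ℕP.≤-trans i≤j (ℕP.m≤n+m j q))))))) (*-zeroʳ (δq q j))
    distrib : ∀ g e s h → (g * e + s) * h ≡ g * (e * h) + s * h
    distrib = solve-∀ ℚ-ring
    interchange : S n (λ i → S n (F i) * hk i) ≡ S n (λ j → δq q j * combination n (d (3 ℕ.+ q ℕ.+ j)))
    interchange = trans (S-cong n (λ i _ → sym (S-*ʳ n (hk i) (F i))))
      (trans (S-S n n (λ i j → F i j * hk i))
      (S-cong n (λ j _ → trans (S-cong n (λ i _ → *-assoc (δq q j) (d (3 ℕ.+ q ℕ.+ j) i) (hk i)))
                               (S-*ˡ n (δq q j) (λ i → d (3 ℕ.+ q ℕ.+ j) i * hk i)))))

  -- Main congruence: W_m ≡ Σ_{i<n} d m i·h_p(i) (mod p^n) for m ≥ 2, provided the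
  -- pivots and ½ are p-integral.  Downward induction on m, measured by g with m + g ≥ n + 3.
  expansion : ∀ n → (∀ q → q ≤ n → Integral (recip (pivot q))) → Integral ½ →
    ∀ g q → 3 ℕ.+ n ≤ 2 ℕ.+ q ℕ.+ g → W (2 ℕ.+ q) ≈ combination n (d (2 ℕ.+ q)) [mod n ]
  expansion n i-pivot i½ zero q bound = expansion-beyond n (2 ℕ.+ q) (subst (3 ℕ.+ n ≤_) (ℕP.+-identityʳ _) bound)
  expansion n i-pivot i½ (suc g) q bound with q ℕ.≤? n
  ... | no q≰n = expansion-beyond n (2 ℕ.+ q) (ℕ.s≤s (ℕ.s≤s (ℕP.≰⇒> q≰n)))
  ... | yes q≤n = ≈-trans (solve-W q n (i-pivot q q≤n))
      (≈-trans (≈-+ (≈-*ˡ (γq q) (integral-γq q (i-pivot q q≤n)) (hk≈combination n (oddIndex q)))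
                    (S-≈ n (λ j _ → ≈-*ˡ (δq q j) (integral-δq q j (i-pivot q q≤n) i½) (higher j))))
               (≡⇒≈ (sym (combination-unfold n q))))
    where
    higher : ∀ j → W (3 ℕ.+ q ℕ.+ j) ≈ combination n (d (3 ℕ.+ q ℕ.+ j)) [mod n ]
    higher j = expansion n i-pivot i½ g (suc q ℕ.+ j) (ℕP.≤-trans bound
      (ℕP.≤-trans (ℕP.≤-reflexive (ℕP.+-suc (2 ℕ.+ q) g)) (ℕP.+-monoˡ-≤ g (ℕP.m≤m+n (3 ℕ.+ q) j))))

  halfSum-expansion : ∀ q n → (∀ q → q ≤ n → Integral (recip (pivot q))) → Integral ½ →
    halfSum (2 ℕ.+ q) p ≈ combination n (d (2 ℕ.+ q)) [mod n ]
  halfSum-expansion q n i-pivot i½ =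
    ≈-trans (≡⇒≈ (halfSum≡W (2 ℕ.+ q))) (expansion n i-pivot i½ (3 ℕ.+ n) q (ℕP.m≤n+m (3 ℕ.+ n) (2 ℕ.+ q)))

  altSum-expansion : ∀ q n → (∀ q → q ≤ n → Integral (recip (pivot q))) → Integral ½ →
    altSum (2 ℕ.+ q) p ≈ combination n (altCoeff (2 ℕ.+ q)) [mod n ]
  altSum-expansion q n i-pivot i½ = ≈-trans (≡⇒≈ (altSum≡ k))
    (≈-trans (≈-+ (≈-*ˡ two (integral-ℕ 2) (≈-*ˡ (½ ^ k) (integral-^ k i½)
                    (expansion n i-pivot i½ (3 ℕ.+ n) q (ℕP.m≤n+m (3 ℕ.+ n) k))))
                  (≈-neg (hk≈combination n k)))
             (≡⇒≈ collect))
    where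
    k = 2 ℕ.+ q
    collect : two * (½ ^ k * combination n (d k)) - combination n (λ i → kronecker i k) ≡ combination n (altCoeff k)
    collect = trans (cong₂ (λ a b → two * a + b) (sym (S-*ˡ n (½ ^ k) _)) (sym (S-neg n _)))
      (trans (cong (_+ S n (λ i → - (kronecker i k * hk i))) (sym (S-*ˡ n two _)))
      (trans (sym (S-+ n _ _)) (S-cong n (λ i _ → regroup two (½ ^ k) (d k i) (hk i) (kronecker i k)))))
      where
      regroup : ∀ t a x y z → t * (a * (x * y)) + - (z * y) ≡ (t * (a * x) - z) * y
      regroup = solve-∀ ℚ-ring

  -- The partial sums of Defs over the compositions single i = (i + 1), with coefficients
  -- v (i + 1), are the truncated combinations (the term of weight n is excluded).
  partialSum-below : ∀ c n M → suc M ≤ n → partialSum c single p n M ≡ S M (λ i → c i * hk (suc i))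
  partialSum-below c n zero    _ = refl
  partialSum-below c n (suc M) M+2≤n with weight (single M) ℕ.<? n
  ... | yes _   = cong (_+ c M * hk (suc M)) (partialSum-below c n M (ℕP.≤-trans (ℕP.n≤1+n _) M+2≤n))
  ... | no w≮n = ⊥-elim (w≮n (subst (ℕ._< n) (sym (ℕP.+-identityʳ (suc M))) M+2≤n))

  partialSum-single : ∀ v → v 0 ≡ 0ℚ → ∀ n → partialSum (λ i → v (suc i)) single p n n ≡ combination n v
  partialSum-single v v0≡0 zero    = refl
  partialSum-single v v0≡0 (suc n) with weight (single n) ℕ.<? suc n
  ... | yes w<n = ⊥-elim (ℕP.<-irrefl (ℕP.+-identityʳ (suc n)) w<n)
  ... | no _    = trans (partialSum-below _ (suc n) n ℕP.≤-refl) (sym (trans (S-first n (λ i → v i * hk i))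
      (trans (cong (λ t → t * hk 0 + rest) v0≡0) (trans (cong (_+ rest) (*-zeroˡ (hk 0))) (+-identityˡ rest)))))
    where
    rest = S n (λ i → v (suc i) * hk (suc i))

parity : ∀ n → (∃ λ h → n ≡ h ℕ.+ h) ⊎ (∃ λ h → n ≡ suc (h ℕ.+ h))
parity zero    = inj₁ (0 , refl)
parity (suc n) with parity n
... | inj₁ (h , n≡2h)   = inj₂ (h , cong suc n≡2h)
... | inj₂ (h , n≡2h+1) = inj₁ (suc h , trans (cong suc n≡2h+1) (cong suc (sym (ℕP.+-suc h h))))

odd-prime : ∀ p → Prime p → 2 ℕ.< p → ∃ λ half → p ≡ suc (half ℕ.+ half)
odd-prime p p-prime 2<p with parity p
... | inj₂ odd = odd
... | inj₁ (h , p≡2h) = ⊥-elim (prime⇒¬composite p-prime (composite 2<p (divides h (trans p≡2h (sym (twice h))))))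
  where
  twice : ∀ h → h ℕ.* 2 ≡ h ℕ.+ h
  twice = ℕSolver.solve-∀

-- Beyond bound n every prime makes ½ and the pivots for q ≤ n p-integral.
pivotSum : ℕ → ℕ
pivotSum zero    = pivot 0
pivotSum (suc n) = pivotSum n ℕ.+ pivot (suc n)

pivot≤pivotSum : ∀ q n → q ≤ n → pivot q ≤ pivotSum n
pivot≤pivotSum q zero    ℕ.z≤n = ℕP.≤-refl
pivot≤pivotSum q (suc n) q≤1+n with ℕP.m≤n⇒m<n∨m≡n q≤1+n
... | inj₂ refl  = ℕP.m≤n+m (pivot (suc n)) (pivotSum n)
... | inj₁ q<1+n = ℕP.≤-trans (pivot≤pivotSum q n (ℕP.≤-pred q<1+n)) (ℕP.m≤m+n (pivotSum n) (pivot (suc n)))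

bound : ℕ → ℕ
bound n = 2 ℕ.+ pivotSum n

large-prime-congruences : ∀ q n p → Prime p → bound n ℕ.< p →
  CongMod p n (halfSum (2 ℕ.+ q) p) (partialSum (λ i → d (2 ℕ.+ q) (suc i)) single p n n) ×
  CongMod p n (altSum (2 ℕ.+ q) p) (partialSum (λ i → altCoeff (2 ℕ.+ q) (suc i)) single p n n)
large-prime-congruences q n p p-prime p>bound with odd-prime p p-prime (ℕP.≤-trans (ℕ.s≤s (ℕ.s≤s (ℕ.s≤s ℕ.z≤n))) p>bound)
... | half , refl =
    ≈⇒CongMod (≈-trans (halfSum-expansion q n i-pivot i½) (≡⇒≈ (sym (partialSum-single (d (2 ℕ.+ q)) (d-at-0 q) n))))
  , ≈⇒CongMod (≈-trans (altSum-expansion q n i-pivot i½) (≡⇒≈ (sym (partialSum-single (altCoeff (2 ℕ.+ q)) (altCoeff-at-0 q) n))))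
  where
  open OddPrime half p-prime hiding (p)
  open Modulo p p-prime
  i½ : Integral ½
  i½ = integral-recip-< 2 (ℕ.s≤s ℕ.z≤n) (ℕP.≤-trans (ℕ.s≤s (ℕ.s≤s (ℕ.s≤s ℕ.z≤n))) p>bound)
  i-pivot : ∀ q → q ≤ n → Integral (recip (pivot q))
  i-pivot q q≤n = integral-recip-< (pivot q) (pivot-pos q)
    (ℕP.≤-trans (ℕ.s≤s (ℕP.≤-trans (pivot≤pivotSum q n q≤n) (ℕP.m≤n+m (pivotSum n) 2))) p>bound)

depth-one-in-MHS : ∀ a (v : ℕ → ℚ) →
  (∀ n → ∃ λ P → ∀ p → Prime p → P ℕ.< p → CongMod p n (a p) (partialSum (λ i → v (suc i)) single p n n)) →
  InWeightedMHS a
depth-one-in-MHS a v congruences = (λ i → v (suc i)) , single , (λ n → n) , (λ i → ℕ.s≤s ℕ.z≤n ∷ []) , weight-grows , congruences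
  where
  weight-grows : ∀ n i → n ≤ i → n ≤ weight (single i)
  weight-grows n i n≤i = ℕP.≤-trans n≤i (ℕP.≤-trans (ℕP.n≤1+n i) (ℕP.≤-reflexive (sym (ℕP.+-identityʳ (suc i)))))

theorem5 : (k : ℕ) → 2 ≤ k → InWeightedMHS (halfSum k) × InWeightedMHS (altSum k)
theorem5 (suc (suc q)) (ℕ.s≤s (ℕ.s≤s ℕ.z≤n)) =
    depth-one-in-MHS (halfSum (2 ℕ.+ q)) (d (2 ℕ.+ q))
      (λ n → bound n , λ p p-prime p>bound → proj₁ (large-prime-congruences q n p p-prime p>bound))
  , depth-one-in-MHS (altSum (2 ℕ.+ q)) (altCoeff (2 ℕ.+ q))
      (λ n → bound n , λ p p-prime p>bound → proj₂ (large-prime-congruences q n p p-prime p>bound))
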